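{- Let $A\subseteq\mathbb{N}\setminus\{0,1,2\}$ with $|A|\geq 2$, and let $\mathcal{G}_A$ be the class of all finite undirected simple graphs $G$ such that (1) the length of every cycle in $G$ is an element of $A$; (2) no two distinct cycles of $G$ share an edge; (3) every cycle of $G$ contains at most two vertices whose degree in $G$ is greater than $2$. Then $\mathcal{G}_A$ fails the cofinal amalgamation property.
   Context: Cycles are simple cycles. Embeddings between graphs are injective maps preserving and reflecting adjacency. A class $\mathcal{F}$ of finite structures has the cofinal amalgamation property (CAP) if for every $Z\in\mathcal{F}$ there is $Z'\in\mathcal{F}$ containing $Z$ as a substructure such that for all embeddings $f\colon Z'\to X$, $g\colon Z'\to Y$ with $X,Y\in\mathcal{F}$ there exist $W\in\mathcal{F}$ and embeddings $f'\colon X\to W$, $g'\colon Y\to W$ with $f'\circ f=g'\circ g$. -}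

module Defs where

open import Data.Nat using (ℕ; zero; suc; _+_; _≤_; _<ᵇ_; NonZero)
open import Data.Nat.DivMod using (_%_; m%n<n)
open import Data.Fin using (Fin; toℕ; fromℕ<)
open import Data.Bool using (Bool; true; false)
open import Data.List using (List; length; filterᵇ)
open import Data.List using () renaming (allFin to allFinL)
open import Data.Product using (Σ; ∃; ∃-syntax; _×_; _,_)
open import Data.Sum using (_⊎_)
open import Relation.Binary.PropositionalEquality using (_≡_; _≢_)
open import Relation.Nullary using (¬_)
open import Function using (_∘_; _⇔_)

record Graph : Set where
  field
    size   : ℕ
    adj    : Fin size → Fin size → Bool
    sym    : ∀ u v → adj u v ≡ adj v u
    irrefl : ∀ v → adj v v ≡ false
open Graph public

degree : (G : Graph) → Fin (size G) → ℕ
degree G v = length (filterᵇ (adj G v) (allFinL (size G)))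

csuc : ∀ {k} → Fin (suc k) → Fin (suc k)
csuc {k} i = fromℕ< (m%n<n (suc (toℕ i)) (suc k))

record Cycle (G : Graph) : Set where
  field
    m     : ℕ
    vert  : Fin (3 + m) → Fin (size G)
    inj   : ∀ i j → vert i ≡ vert j → i ≡ j
    edges : ∀ i → adj G (vert i) (vert (csuc i)) ≡ true
open Cycle public

cycleLength : ∀ {G} → Cycle G → ℕ
cycleLength c = 3 + m c

CycleEdge : ∀ {G} → Cycle G → Fin (size G) → Fin (size G) → Set
CycleEdge c u v =
  ∃[ i ] ((vert c i ≡ u × vert c (csuc i) ≡ v) ⊎ (vert c i ≡ v × vert c (csuc i) ≡ u))

-- Two cycles are the same (as subgraphs) iff they have the same edge set.
SameCycle : ∀ {G} → Cycle G → Cycle G → Set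
SameCycle c d = ∀ u v → CycleEdge c u v ⇔ CycleEdge d u v

highDegreeCount : ∀ {G} → Cycle G → ℕ
highDegreeCount {G} c = length (filterᵇ (λ i → 2 <ᵇ degree G (vert c i)) (allFinL (3 + m c)))

InGA : (ℕ → Set) → Graph → Set
InGA A G =
  (∀ (c : Cycle G) → A (cycleLength c))
  × (∀ (c d : Cycle G) u v → CycleEdge c u v → CycleEdge d u v → SameCycle c d)
  × (∀ (c : Cycle G) → highDegreeCount c ≤ 2)

record Embedding (G H : Graph) : Set where
  field
    fun      : Fin (size G) → Fin (size H)
    injective : ∀ u v → fun u ≡ fun v → u ≡ v
    adj-pres : ∀ u v → adj H (fun u) (fun v) ≡ adj G u v
open Embedding public

CAP : (Graph → Set) → Set
CAP 𝓕 =
  ∀ Z → 𝓕 Z →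
    Σ Graph λ Z' → 𝓕 Z' × Embedding Z Z' ×
      (∀ X Y → 𝓕 X → 𝓕 Y → (f : Embedding Z' X) → (g : Embedding Z' Y) →
        Σ Graph λ W → 𝓕 W ×
          Σ (Embedding X W) λ f' → Σ (Embedding Y W) λ g' →
            ∀ z → fun f' (fun f z) ≡ fun g' (fun g z))

module Submission where

-- Applying the cofinal amalgamation property to the one-edge graph K₂ yields Z ∈ 𝒢_A with an
-- edge, over which any two extensions in 𝒢_A amalgamate.  As the cycles of Z are edge-disjoint,
-- Z has a pendant edge or a cycle with at most one vertex of degree ≥ 3; both are found by
-- a search for a path maximising first the number of such high vertices, then its length.
-- A pendant edge uv closes, through new vertices, into cycles of two different lengths a ≠ b
-- in A, and an amalgam of the two extensions would have two distinct cycles sharing uv.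
-- If C has at most one high vertex t, hang leaves at t and t + 1 in one extension and at
-- t and t − 1 in the other: in an amalgam the image of C has three high vertices.

open import Defs
open import Data.Nat using (ℕ; zero; suc; _+_; _∸_; _*_; _≤_; _<_; z≤n; s≤s; _<ᵇ_; _%_)
import Data.Nat.Properties as ℕₚ
open import Data.Nat.DivMod using (m<n⇒m%n≡m; n%n≡0; m%n%n≡m%n; %-distribˡ-+; [m+n]%n≡m%n)
open import Data.Fin as Fin using (Fin; toℕ; fromℕ<; splitAt; _↑ˡ_; _↑ʳ_)
import Data.Fin.Properties as Finₚ
open import Data.Fin.Properties using (toℕ-injective; toℕ-fromℕ<; fromℕ<-toℕ; toℕ<n)
open import Data.Bool using (Bool; true; false; not; T)
open import Data.Bool.Properties using (T-≡)
open import Data.List using (List; []; _∷_; length; filterᵇ; lookup)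
open import Data.List using () renaming (allFin to allFinL)
open import Data.List.Membership.Propositional.Properties using (∈-filter⁺; ∈-filter⁻; ∈-allFin; ∈-lookup)
open import Data.List.Relation.Unary.Any using (index)
open import Data.List.Relation.Unary.Any.Properties using (lookup-index)
open import Data.List.Relation.Unary.Unique.Propositional using (Unique)
open import Data.List.Relation.Unary.AllPairs using (_∷_)
import Data.List.Relation.Unary.All as All
open import Data.List.Relation.Unary.Unique.Propositional.Properties using (allFin⁺; filter⁺)
open import Data.Product using (Σ; ∃; _×_; _,_; proj₁; proj₂)
open import Data.Sum using (_⊎_; inj₁; inj₂; swap; [_,_]′)
open import Data.Empty using (⊥; ⊥-elim)
open import Relation.Binary.PropositionalEquality as ≡ using (_≡_; _≢_; refl; trans; cong; cong₂; subst; subst₂; module ≡-Reasoning)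
open import Relation.Nullary using (¬_; Dec; does; yes; no; _×-dec_; _⊎-dec_; ¬?)
open import Relation.Nullary.Decidable using (T?; dec-true; dec-false; does-⇔)
open import Relation.Binary using (Tri)
open import Function using (_∘_)
open import Function.Bundles using (Equivalence; mk⇔)

≡true⇒T : ∀ {b} → b ≡ true → T b
≡true⇒T = Equivalence.from T-≡

T⇒≡true : ∀ {b} → T b → b ≡ true
T⇒≡true = Equivalence.to T-≡

true≢false : true ≢ false
true≢false ()

does⇒ : ∀ {P : Set} (d : Dec P) → does d ≡ true → P
does⇒ (yes p) _ = p

lookup-injective : ∀ {A : Set} {xs : List A} → Unique xs → ∀ i j → lookup xs i ≡ lookup xs j → i ≡ j
lookup-injective (p ∷ u) Fin.zero Fin.zero e = refl
lookup-injective (p ∷ u) Fin.zero (Fin.suc j) e = ⊥-elim (All.lookup p (∈-lookup j) e)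
lookup-injective (p ∷ u) (Fin.suc i) Fin.zero e = ⊥-elim (All.lookup p (∈-lookup i) (≡.sym e))
lookup-injective (p ∷ u) (Fin.suc i) (Fin.suc j) e = cong Fin.suc (lookup-injective u i j e)

count : ∀ {n} → (Fin n → Bool) → ℕ
count {n} q = length (filterᵇ q (allFinL n))

count-cong : ∀ {n} {q q′ : Fin n → Bool} → (∀ x → q x ≡ q′ x) → count q ≡ count q′
count-cong {n} {q} {q′} e = go (allFinL n)
  where
  go : ∀ xs → length (filterᵇ q xs) ≡ length (filterᵇ q′ xs)
  go [] = refl
  go (x ∷ xs) with q x | q′ x | e x
  ... | true  | true  | refl = cong suc (go xs)
  ... | false | false | refl = go xs

module _ {n} (q : Fin n → Bool) where
  private
    selected = filterᵇ q (allFinL n)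

  lookup-selected : ∀ i → q (lookup selected i) ≡ true
  lookup-selected i = T⇒≡true (proj₂ (∈-filter⁻ (T? ∘ q) {xs = allFinL n} (∈-lookup i)))

  lookup-selected-injective : ∀ i j → lookup selected i ≡ lookup selected j → i ≡ j
  lookup-selected-injective = lookup-injective (filter⁺ (T? ∘ q) (allFin⁺ n))

  injective⇒≤count : ∀ {m} (h : Fin m → Fin n) → (∀ i j → h i ≡ h j → i ≡ j) →
    (∀ i → q (h i) ≡ true) → m ≤ count q
  injective⇒≤count h h-inj qh = Finₚ.injective⇒≤ {f = position} position-injective
    where
    member = λ i → ∈-filter⁺ (T? ∘ q) (∈-allFin (h i)) (≡true⇒T (qh i))
    position = λ i → index (member i)
    position-injective : ∀ {i j} → position i ≡ position j → i ≡ j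
    position-injective {i} {j} e = h-inj i j (begin
      h i                       ≡⟨ lookup-index (member i) ⟩
      lookup selected (position i) ≡⟨ cong (lookup selected) e ⟩
      lookup selected (position j) ≡⟨ ≡.sym (lookup-index (member j)) ⟩
      h j                       ∎)
      where open ≡-Reasoning

  count≤-injectiveOn : ∀ {m} (g : Fin n → Fin m) →
    (∀ x y → q x ≡ true → q y ≡ true → g x ≡ g y → x ≡ y) → count q ≤ m
  count≤-injectiveOn g g-inj = Finₚ.injective⇒≤ {f = g ∘ lookup selected} λ {i} {j} e →
    lookup-selected-injective i j (g-inj _ _ (lookup-selected i) (lookup-selected j) e)

  3≤count : ∀ {a b c} → a ≢ b → a ≢ c → b ≢ c →
    q a ≡ true → q b ≡ true → q c ≡ true → 3 ≤ count q
  3≤count {a} {b} {c} a≢b a≢c b≢c qa qb qc = injective⇒≤count h h-inj qh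
    where
    h : Fin 3 → Fin n
    h Fin.zero = a
    h (Fin.suc Fin.zero) = b
    h (Fin.suc (Fin.suc Fin.zero)) = c
    qh : ∀ i → q (h i) ≡ true
    qh Fin.zero = qa
    qh (Fin.suc Fin.zero) = qb
    qh (Fin.suc (Fin.suc Fin.zero)) = qc
    h-inj : ∀ i j → h i ≡ h j → i ≡ j
    h-inj Fin.zero Fin.zero e = refl
    h-inj Fin.zero (Fin.suc Fin.zero) e = ⊥-elim (a≢b e)
    h-inj Fin.zero (Fin.suc (Fin.suc Fin.zero)) e = ⊥-elim (a≢c e)
    h-inj (Fin.suc Fin.zero) Fin.zero e = ⊥-elim (a≢b (≡.sym e))
    h-inj (Fin.suc Fin.zero) (Fin.suc Fin.zero) e = refl
    h-inj (Fin.suc Fin.zero) (Fin.suc (Fin.suc Fin.zero)) e = ⊥-elim (b≢c e)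
    h-inj (Fin.suc (Fin.suc Fin.zero)) Fin.zero e = ⊥-elim (a≢c (≡.sym e))
    h-inj (Fin.suc (Fin.suc Fin.zero)) (Fin.suc Fin.zero) e = ⊥-elim (b≢c (≡.sym e))
    h-inj (Fin.suc (Fin.suc Fin.zero)) (Fin.suc (Fin.suc Fin.zero)) e = refl

  2≤count : ∀ {a b} → a ≢ b → q a ≡ true → q b ≡ true → 2 ≤ count q
  2≤count {a} {b} a≢b qa qb = injective⇒≤count h h-inj qh
    where
    h : Fin 2 → Fin n
    h Fin.zero = a
    h (Fin.suc _) = b
    qh : ∀ i → q (h i) ≡ true
    qh Fin.zero = qa
    qh (Fin.suc _) = qb
    h-inj : ∀ i j → h i ≡ h j → i ≡ j
    h-inj Fin.zero Fin.zero e = refl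
    h-inj Fin.zero (Fin.suc Fin.zero) e = ⊥-elim (a≢b e)
    h-inj (Fin.suc Fin.zero) Fin.zero e = ⊥-elim (a≢b (≡.sym e))
    h-inj (Fin.suc Fin.zero) (Fin.suc Fin.zero) e = refl

  count≤1 : (∀ x y → q x ≡ true → q y ≡ true → x ≡ y) → count q ≤ 1
  count≤1 all-equal = count≤-injectiveOn (λ _ → Fin.zero) (λ x y qx qy _ → all-equal x y qx qy)

  count≤2 : ∀ {m} (f : Fin n → Fin m) (a b : Fin m) → (∀ i j → f i ≡ f j → i ≡ j) →
    (∀ i → q i ≡ true → f i ≡ a ⊎ f i ≡ b) → count q ≤ 2
  count≤2 f a b f-inj into = count≤-injectiveOn side side-injective
    where
    side : Fin n → Fin 2
    side i with f i Finₚ.≟ a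
    ... | yes _ = Fin.zero
    ... | no _ = Fin.suc Fin.zero
    side-injective : ∀ x y → q x ≡ true → q y ≡ true → side x ≡ side y → x ≡ y
    side-injective x y qx qy e with f x Finₚ.≟ a | f y Finₚ.≟ a
    ... | yes p | yes p′ = f-inj x y (trans p (≡.sym p′))
    ... | yes _ | no _ = ⊥-elim (Finₚ.0≢1+n e)
    ... | no _ | yes _ = ⊥-elim (Finₚ.0≢1+n (≡.sym e))
    ... | no p | no p′ with into x qx | into y qy
    ... | inj₁ r | _ = ⊥-elim (p r)
    ... | _ | inj₁ r = ⊥-elim (p′ r)
    ... | inj₂ r | inj₂ r′ = f-inj x y (trans r (≡.sym r′))

module _ {k : ℕ} where

  toℕ-csuc : ∀ (i : Fin (suc k)) → toℕ (csuc i) ≡ suc (toℕ i) % suc k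
  toℕ-csuc i = toℕ-fromℕ< _

  toℕ-csuc-< : ∀ (i : Fin (suc k)) → suc (toℕ i) < suc k → toℕ (csuc i) ≡ suc (toℕ i)
  toℕ-csuc-< i lt = trans (toℕ-csuc i) (m<n⇒m%n≡m lt)

  toℕ-csuc-last : ∀ (i : Fin (suc k)) → toℕ i ≡ k → toℕ (csuc i) ≡ 0
  toℕ-csuc-last i e = trans (toℕ-csuc i) (subst (λ z → suc z % suc k ≡ 0) (≡.sym e) (n%n≡0 (suc k)))

  csuc-view : ∀ (i : Fin (suc k)) →
    (suc (toℕ i) < suc k × toℕ (csuc i) ≡ suc (toℕ i)) ⊎ (toℕ i ≡ k × toℕ (csuc i) ≡ 0)
  csuc-view i with ℕₚ.m≤n⇒m<n∨m≡n (toℕ<n i)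
  ... | inj₁ lt = inj₁ (lt , toℕ-csuc-< i lt)
  ... | inj₂ eq = inj₂ (ℕₚ.suc-injective eq , toℕ-csuc-last i (ℕₚ.suc-injective eq))

  csuc^ : ℕ → Fin (suc k) → Fin (suc k)
  csuc^ zero i = i
  csuc^ (suc n) i = csuc (csuc^ n i)

  toℕ-csuc^ : ∀ n (i : Fin (suc k)) → toℕ (csuc^ n i) ≡ (toℕ i + n) % suc k
  toℕ-csuc^ zero i = ≡.sym (trans (cong (_% suc k) (ℕₚ.+-identityʳ (toℕ i))) (m<n⇒m%n≡m (toℕ<n i)))
  toℕ-csuc^ (suc n) i = begin
    toℕ (csuc (csuc^ n i))          ≡⟨ toℕ-csuc (csuc^ n i) ⟩
    suc (toℕ (csuc^ n i)) % suc k   ≡⟨ cong (λ x → suc x % suc k) (toℕ-csuc^ n i) ⟩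
    (1 + (toℕ i + n) % suc k) % suc k ≡⟨ %-distribˡ-+ 1 _ (suc k) ⟩
    (1 % suc k + (toℕ i + n) % suc k % suc k) % suc k
      ≡⟨ cong (λ x → (1 % suc k + x) % suc k) (m%n%n≡m%n (toℕ i + n) (suc k)) ⟩
    (1 % suc k + (toℕ i + n) % suc k) % suc k ≡⟨ %-distribˡ-+ 1 (toℕ i + n) (suc k) ⟨
    (1 + (toℕ i + n)) % suc k       ≡⟨ cong (_% suc k) (≡.sym (ℕₚ.+-suc (toℕ i) n)) ⟩
    (toℕ i + suc n) % suc k         ∎
    where open ≡-Reasoning

  csuc^-reaches : ∀ (i j : Fin (suc k)) → csuc^ (suc k ∸ toℕ i + toℕ j) i ≡ j
  csuc^-reaches i j = toℕ-injective (begin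
    toℕ (csuc^ (suc k ∸ toℕ i + toℕ j) i)   ≡⟨ toℕ-csuc^ _ i ⟩
    (toℕ i + (suc k ∸ toℕ i + toℕ j)) % suc k ≡⟨ cong (_% suc k) (≡.sym (ℕₚ.+-assoc (toℕ i) _ (toℕ j))) ⟩
    (toℕ i + (suc k ∸ toℕ i) + toℕ j) % suc k ≡⟨ cong (λ x → (x + toℕ j) % suc k) (ℕₚ.m+[n∸m]≡n (ℕₚ.<⇒≤ (toℕ<n i))) ⟩
    (suc k + toℕ j) % suc k                  ≡⟨ cong (_% suc k) (ℕₚ.+-comm (suc k) (toℕ j)) ⟩
    (toℕ j + suc k) % suc k                  ≡⟨ [m+n]%n≡m%n (toℕ j) (suc k) ⟩
    toℕ j % suc k                            ≡⟨ m<n⇒m%n≡m (toℕ<n j) ⟩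
    toℕ j                                    ∎)
    where open ≡-Reasoning

  cycle-induction : (T : Fin (suc k) → Set) → ∀ i₀ → T i₀ → (∀ i → T i → T (csuc i)) → ∀ i → T i
  cycle-induction T i₀ t₀ step i = subst T (csuc^-reaches i₀ i) (iterate (suc k ∸ toℕ i₀ + toℕ i))
    where
    iterate : ∀ n → T (csuc^ n i₀)
    iterate zero = t₀
    iterate (suc n) = step _ (iterate n)

  cpred : Fin (suc k) → Fin (suc k)
  cpred = csuc^ k

  csuc-cpred : ∀ i → csuc (cpred i) ≡ i
  csuc-cpred i = toℕ-injective (trans (toℕ-csuc^ (suc k) i)
    (trans ([m+n]%n≡m%n (toℕ i) (suc k)) (m<n⇒m%n≡m (toℕ<n i))))

  cpred-csuc : ∀ i → cpred (csuc i) ≡ i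
  cpred-csuc i = trans (csuc^-csuc k i) (csuc-cpred i)
    where
    csuc^-csuc : ∀ n i → csuc^ n (csuc i) ≡ csuc (csuc^ n i)
    csuc^-csuc zero i = refl
    csuc^-csuc (suc n) i = cong csuc (csuc^-csuc n i)

  cpred-view : ∀ (i : Fin (suc k)) → (toℕ i ≡ 0 × toℕ (cpred i) ≡ k) ⊎ (toℕ i ≡ suc (toℕ (cpred i)))
  cpred-view i with csuc-view (cpred i)
  ... | inj₁ (_ , e) = inj₂ (trans (cong toℕ (≡.sym (csuc-cpred i))) e)
  ... | inj₂ (last , e) = inj₁ (trans (cong toℕ (≡.sym (csuc-cpred i))) e , last)

module _ {m : ℕ} where

  csuc≢id : ∀ (i : Fin (3 + m)) → csuc i ≢ i
  csuc≢id i e with csuc-view i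
  ... | inj₁ (_ , q) = ℕₚ.1+n≢n (trans (≡.sym q) (cong toℕ e))
  ... | inj₂ (p , q) = ℕₚ.1+n≢0 (trans (≡.sym p) (trans (cong toℕ (≡.sym e)) q))

  csuc²≢id : ∀ (i : Fin (3 + m)) → csuc (csuc i) ≢ i
  csuc²≢id i e with csuc-view i | csuc-view (csuc i)
  ... | inj₁ (_ , q) | inj₁ (_ , q2) = ℕₚ.m+1+n≢m (toℕ i) {1} (trans (ℕₚ.+-comm (toℕ i) 2) (trans (cong suc (≡.sym q)) (trans (≡.sym q2) (cong toℕ e))))
  ... | inj₁ (_ , q) | inj₂ (p2 , q2) = ℕₚ.1+n≢0 {m} (ℕₚ.suc-injective (trans (≡.sym p2) (trans q (cong suc (trans (cong toℕ (≡.sym e)) q2)))))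
  ... | inj₂ (p , q) | inj₁ (_ , q2) = ℕₚ.1+n≢0 {m} (ℕₚ.suc-injective (trans (≡.sym p) (trans (cong toℕ (≡.sym e)) (trans q2 (cong suc q)))))
  ... | inj₂ (p , q) | inj₂ (p2 , q2) = ℕₚ.1+n≢0 {suc m} (trans (≡.sym p2) q)

  cpred≢id : ∀ (i : Fin (3 + m)) → cpred i ≢ i
  cpred≢id i e = csuc≢id (cpred i) (trans (csuc-cpred i) (≡.sym e))

  cpred≢csuc : ∀ (i : Fin (3 + m)) → cpred i ≢ csuc i
  cpred≢csuc i e = csuc²≢id i (trans (cong csuc (≡.sym e)) (csuc-cpred i))

High : (G : Graph) → Fin (size G) → Set
High G v = 3 ≤ degree G v

High? : ∀ G v → Dec (High G v)
High? G v = 3 ℕₚ.≤? degree G v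

highᵇ : (G : Graph) → Fin (size G) → Bool
highᵇ G v = 2 <ᵇ degree G v

highᵇ⇒High : ∀ G v → highᵇ G v ≡ true → High G v
highᵇ⇒High G v e = ℕₚ.<ᵇ⇒< 2 (degree G v) (≡true⇒T e)

High⇒highᵇ : ∀ G v → High G v → highᵇ G v ≡ true
High⇒highᵇ G v h = T⇒≡true (ℕₚ.<⇒<ᵇ h)

¬High⇒highᵇ : ∀ G v → ¬ High G v → highᵇ G v ≡ false
¬High⇒highᵇ G v ¬h with highᵇ G v in e
... | true = ⊥-elim (¬h (highᵇ⇒High G v e))
... | false = refl

CyclesShareNoEdge : Graph → Set
CyclesShareNoEdge G = ∀ (c d : Cycle G) u v → CycleEdge c u v → CycleEdge d u v → SameCycle c d

OnCycle : ∀ {G} → Cycle G → Fin (size G) → Set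
OnCycle c z = ∃ λ i → vert c i ≡ z

module _ {G : Graph} (c : Cycle G) where

  prev next : Fin (3 + m c) → Fin (size G)
  prev i = vert c (cpred i)
  next i = vert c (csuc i)

  adj-next : ∀ i → adj G (vert c i) (next i) ≡ true
  adj-next i = edges c i

  adj-prev : ∀ i → adj G (vert c i) (prev i) ≡ true
  adj-prev i = trans (sym G (vert c i) (prev i))
    (subst (λ z → adj G (prev i) (vert c z) ≡ true) (csuc-cpred i) (edges c (cpred i)))

  prev≢next : ∀ i → prev i ≢ next i
  prev≢next i e = cpred≢csuc i (inj c _ _ e)

  lowDegree-nbr : ∀ i y → degree G (vert c i) ≤ 2 → adj G (vert c i) y ≡ true → y ≡ prev i ⊎ y ≡ next i
  lowDegree-nbr i y d a with y Finₚ.≟ prev i | y Finₚ.≟ next i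
  ... | yes p | _ = inj₁ p
  ... | no _ | yes p = inj₂ p
  ... | no p | no q = ⊥-elim (ℕₚ.≤⇒≯ d (3≤count (adj G (vert c i)) (prev≢next i) (p ∘ ≡.sym) (q ∘ ≡.sym)
                                          (adj-prev i) (adj-next i) a))

  cycleEdge-next : ∀ i → CycleEdge c (vert c i) (next i)
  cycleEdge-next i = i , inj₁ (refl , refl)

  cycleEdge-prev : ∀ i → CycleEdge c (vert c i) (prev i)
  cycleEdge-prev i = cpred i , inj₂ (refl , cong (vert c) (csuc-cpred i))

  cycleEdge-sym : ∀ {x y} → CycleEdge c x y → CycleEdge c y x
  cycleEdge-sym (i , inj₁ e) = i , inj₂ e
  cycleEdge-sym (i , inj₂ e) = i , inj₁ e

  cycleEdge-ends : ∀ {x y} → CycleEdge c x y → OnCycle c x × OnCycle c y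
  cycleEdge-ends (i , inj₁ (p , q)) = (i , p) , (csuc i , q)
  cycleEdge-ends (i , inj₂ (p , q)) = (csuc i , q) , (i , p)

  cycleEdge-adj : ∀ {x y} → CycleEdge c x y → adj G x y ≡ true
  cycleEdge-adj (i , inj₁ (refl , refl)) = edges c i
  cycleEdge-adj (i , inj₂ (refl , refl)) = trans (sym G _ _) (edges c i)

  lowDegree-cycleEdge : ∀ i y → degree G (vert c i) ≤ 2 → adj G (vert c i) y ≡ true → CycleEdge c (vert c i) y
  lowDegree-cycleEdge i y d a with lowDegree-nbr i y d a
  ... | inj₁ q = subst (CycleEdge c (vert c i)) (≡.sym q) (cycleEdge-prev i)
  ... | inj₂ q = subst (CycleEdge c (vert c i)) (≡.sym q) (cycleEdge-next i)

sharedEdge⇒OnCycle⊆ : ∀ {G} → CyclesShareNoEdge G → (c d : Cycle G) → ∀ {x y} →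
  CycleEdge c x y → CycleEdge d x y → ∀ z → OnCycle c z → OnCycle d z
sharedEdge⇒OnCycle⊆ share c d e₁ e₂ z (i , refl) =
  proj₁ (cycleEdge-ends d (Equivalence.to (share c d _ _ e₁ e₂ (vert c i) (next c i)) (cycleEdge-next c i)))

OnCycle⊆⇒length≤ : ∀ {G} (c d : Cycle G) → (∀ i → OnCycle d (vert c i)) → cycleLength c ≤ cycleLength d
OnCycle⊆⇒length≤ c d on = Finₚ.injective⇒≤ {f = λ i → proj₁ (on i)} λ {i} {j} e →
  inj c i j (trans (≡.sym (proj₂ (on i))) (trans (cong (vert d) e) (proj₂ (on j))))

module _ {G H : Graph} (e : Embedding G H) where

  private
    nbrs : ∀ (G : Graph) v → List (Fin (size G))
    nbrs G v = filterᵇ (adj G v) (allFinL (size G))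

  degree-mono : ∀ v → degree G v ≤ degree H (fun e v)
  degree-mono v = injective⇒≤count (adj H (fun e v)) (fun e ∘ lookup (nbrs G v))
    (λ i j eq → lookup-selected-injective (adj G v) i j (injective e _ _ eq))
    (λ i → trans (adj-pres e v _) (lookup-selected (adj G v) i))

  High-mono : ∀ v → High G v → High H (fun e v)
  High-mono v h = ℕₚ.≤-trans h (degree-mono v)

  degree-reflect : ∀ v → (∀ y → adj H (fun e v) y ≡ true → ∃ λ y′ → fun e y′ ≡ y) →
    degree H (fun e v) ≡ degree G v
  degree-reflect v inImage = ℕₚ.≤-antisym (injective⇒≤count (adj G v) preimage preimage-inj adj-preimage) (degree-mono v)
    where
    nbr = lookup (nbrs H (fun e v))
    adj-nbr = lookup-selected (adj H (fun e v))
    preimage = λ i → proj₁ (inImage (nbr i) (adj-nbr i))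
    preimage-inj : ∀ i j → preimage i ≡ preimage j → i ≡ j
    preimage-inj i j eq = lookup-selected-injective (adj H (fun e v)) i j
      (trans (≡.sym (proj₂ (inImage _ (adj-nbr i)))) (trans (cong (fun e) eq) (proj₂ (inImage _ (adj-nbr j)))))
    adj-preimage : ∀ i → adj G v (preimage i) ≡ true
    adj-preimage i = trans (≡.sym (adj-pres e v (preimage i)))
      (trans (cong (adj H (fun e v)) (proj₂ (inImage _ (adj-nbr i)))) (adj-nbr i))

  mapCycle : Cycle G → Cycle H
  mapCycle c = record
    { m = m c ; vert = fun e ∘ vert c
    ; inj = λ i j eq → inj c i j (injective e _ _ eq)
    ; edges = λ i → trans (adj-pres e _ _) (edges c i) }

  InImage : Cycle H → Set
  InImage c = ∀ i → ∃ λ w → fun e w ≡ vert c i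

  module _ (c : Cycle H) (pre : InImage c) where

    pullCycle : Cycle G
    pullCycle = record
      { m = m c ; vert = λ i → proj₁ (pre i)
      ; inj = λ i j eq → inj c i j (trans (≡.sym (proj₂ (pre i))) (trans (cong (fun e) eq) (proj₂ (pre j))))
      ; edges = λ i → trans (≡.sym (adj-pres e _ _)) (trans (cong₂ (adj H) (proj₂ (pre i)) (proj₂ (pre (csuc i)))) (edges c i)) }

    pullCycle-vert : ∀ i → fun e (vert pullCycle i) ≡ vert c i
    pullCycle-vert i = proj₂ (pre i)

    pullCycle-edge⇒edge : ∀ {x y} → CycleEdge pullCycle x y → CycleEdge c (fun e x) (fun e y)
    pullCycle-edge⇒edge (i , inj₁ (refl , refl)) = i , inj₁ (≡.sym (pullCycle-vert i) , ≡.sym (pullCycle-vert (csuc i)))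
    pullCycle-edge⇒edge (i , inj₂ (refl , refl)) = i , inj₂ (≡.sym (pullCycle-vert i) , ≡.sym (pullCycle-vert (csuc i)))

    edge⇒pullCycle-edge : ∀ {x y} → CycleEdge c x y →
      ∃ λ x′ → ∃ λ y′ → fun e x′ ≡ x × fun e y′ ≡ y × CycleEdge pullCycle x′ y′
    edge⇒pullCycle-edge (i , inj₁ (refl , refl)) = _ , _ , pullCycle-vert i , pullCycle-vert (csuc i) , (i , inj₁ (refl , refl))
    edge⇒pullCycle-edge (i , inj₂ (refl , refl)) = _ , _ , pullCycle-vert (csuc i) , pullCycle-vert i , (i , inj₂ (refl , refl))

record Path (G : Graph) : Set where
  field
    len : ℕ
    at : ℕ → Fin (size G)
    at-injective : ∀ s t → s ≤ len → t ≤ len → at s ≡ at t → s ≡ t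
    at-adj : ∀ s → s < len → adj G (at s) (at (suc s)) ≡ true
open Path public

offset≤ : ∀ {i s l} → i ≤ l → s ≤ l ∸ i → i + s ≤ l
offset≤ {i} {s} {l} il sl = subst (i + s ≤_) (ℕₚ.m+[n∸m]≡n il) (ℕₚ.+-monoʳ-≤ i sl)

module _ {G : Graph} where
  OnPath : Path G → Fin (size G) → Set
  OnPath P x = ∃ λ s → s ≤ len P × at P s ≡ x

  onPath? : ∀ P x → Dec (OnPath P x)
  onPath? P x with Finₚ.any? {n = suc (len P)} (λ s → at P (toℕ s) Finₚ.≟ x)
  ... | yes (s , e) = yes (toℕ s , ℕₚ.≤-pred (toℕ<n s) , e)
  ... | no ne = no λ where (s , le , e) → ne (fromℕ< (s≤s le) , subst (λ z → at P z ≡ x) (≡.sym (toℕ-fromℕ< (s≤s le))) e)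

  len<size : ∀ (P : Path G) → len P < size G
  len<size P = Finₚ.injective⇒≤ {f = λ (s : Fin (suc (len P))) → at P (toℕ s)}
    λ {s} {t} e → toℕ-injective (at-injective P _ _ (ℕₚ.≤-pred (toℕ<n s)) (ℕₚ.≤-pred (toℕ<n t)) e)

  dropPath : (P : Path G) → (i : ℕ) → i ≤ len P → Path G
  dropPath P i il = record
    { len = len P ∸ i ; at = λ s → at P (i + s)
    ; at-injective = λ s t ls lt e → ℕₚ.+-cancelˡ-≡ i s t (at-injective P _ _ (offset≤ il ls) (offset≤ il lt) e)
    ; at-adj = λ s lt → subst (λ z → adj G (at P (i + s)) (at P z) ≡ true) (≡.sym (ℕₚ.+-suc i s))
                 (at-adj P (i + s) (subst (_≤ len P) (ℕₚ.+-suc i s) (offset≤ il lt))) }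

  consPath : (P : Path G) → (w : Fin (size G)) → ¬ OnPath P w → adj G w (at P 0) ≡ true → Path G
  consPath P w w∉P w~P = record { len = suc (len P) ; at = at′ ; at-injective = at′-injective ; at-adj = at′-adj }
    where
    at′ : ℕ → Fin (size G)
    at′ zero = w
    at′ (suc s) = at P s
    at′-injective : ∀ s t → s ≤ suc (len P) → t ≤ suc (len P) → at′ s ≡ at′ t → s ≡ t
    at′-injective zero zero _ _ _ = refl
    at′-injective zero (suc t) _ lt e = ⊥-elim (w∉P (t , ℕₚ.≤-pred lt , ≡.sym e))
    at′-injective (suc s) zero ls _ e = ⊥-elim (w∉P (s , ℕₚ.≤-pred ls , e))
    at′-injective (suc s) (suc t) ls lt e = cong suc (at-injective P s t (ℕₚ.≤-pred ls) (ℕₚ.≤-pred lt) e)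
    at′-adj : ∀ s → s < suc (len P) → adj G (at′ s) (at′ (suc s)) ≡ true
    at′-adj zero _ = w~P
    at′-adj (suc s) lt = at-adj P s (ℕₚ.≤-pred lt)

bit : Bool → ℕ
bit true = 1
bit false = 0

countBelow : (ℕ → Bool) → ℕ → ℕ
countBelow f zero = 0
countBelow f (suc k) = bit (f 0) + countBelow (f ∘ suc) k

countBelow≤ : ∀ f k → countBelow f k ≤ k
countBelow≤ f zero = z≤n
countBelow≤ f (suc k) with f 0
... | true = s≤s (countBelow≤ (f ∘ suc) k)
... | false = ℕₚ.m≤n⇒m≤1+n (countBelow≤ (f ∘ suc) k)

countBelow-drop : ∀ f i k → (∀ s → s < i → f s ≡ false) → i ≤ k → countBelow f (suc k) ≡ countBelow (λ s → f (i + s)) (suc (k ∸ i))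
countBelow-drop f zero k low le = refl
countBelow-drop f (suc i) (suc k) low (s≤s le) with f 0 | low 0 (s≤s z≤n)
... | false | refl = countBelow-drop (f ∘ suc) i k (λ s lt → low (suc s) (s≤s lt)) le

PendantEdge : Graph → Set
PendantEdge G = Σ (Fin (size G)) λ v → Σ (Fin (size G)) λ u → adj G v u ≡ true × (∀ y → adj G v y ≡ true → y ≡ u)

module _ {G : Graph} where
  highCount : Path G → ℕ
  highCount P = countBelow (highᵇ G ∘ at P) (suc (len P))

  highCount≤size : ∀ (P : Path G) → highCount P ≤ size G
  highCount≤size P = ℕₚ.≤-trans (countBelow≤ (highᵇ G ∘ at P) (suc (len P))) (len<size P)

  data HeadCase (P : Path G) : Set where
    extend  : ∀ w → ¬ OnPath P w → adj G w (at P 0) ≡ true → HeadCase P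
    pendant : PendantEdge G → HeadCase P
    chord   : ∀ q → 2 ≤ q → q ≤ len P → adj G (at P q) (at P 0) ≡ true → HeadCase P

  headCase : (P : Path G) → 1 ≤ len P → HeadCase P
  headCase P 1≤len with Finₚ.any? (λ w → (adj G (at P 0) w Data.Bool.≟ true) ×-dec ¬? (onPath? P w))
  ... | yes (w , a , w∉P) = extend w w∉P (trans (sym G w (at P 0)) a)
  ... | no allOnPath with Finₚ.any? (λ w → (adj G (at P 0) w Data.Bool.≟ true) ×-dec ¬? (w Finₚ.≟ at P 1))
  ...   | no onlyNext = pendant (at P 0 , at P 1 , at-adj P 0 1≤len , nbr≡next)
    where
    nbr≡next : ∀ y → adj G (at P 0) y ≡ true → y ≡ at P 1
    nbr≡next y a with y Finₚ.≟ at P 1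
    ... | yes e = e
    ... | no ne = ⊥-elim (onlyNext (y , a , ne))
  ...   | yes (y , a , y≢next) with onPath? P y
  ...     | no y∉P = ⊥-elim (allOnPath (y , a , y∉P))
  ...     | yes (zero , _ , e) = ⊥-elim (true≢false (trans (≡.sym a) (trans (cong (adj G (at P 0)) (≡.sym e)) (irrefl G (at P 0)))))
  ...     | yes (suc zero , _ , e) = ⊥-elim (y≢next (≡.sym e))
  ...     | yes (suc (suc q) , q≤len , e) = chord (2 + q) (s≤s (s≤s z≤n)) q≤len
                                                (trans (cong (λ z → adj G z (at P 0)) e) (trans (sym G y (at P 0)) a))

record ChordCycle {G : Graph} (P : Path G) (a b : ℕ) : Set where
  field
    cyc : Cycle G
    on⇒range : ∀ x → OnCycle cyc x → Σ ℕ λ s → a ≤ s × s ≤ b × at P s ≡ x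
    range⇒on : ∀ s → a ≤ s → s ≤ b → OnCycle cyc (at P s)
    edge : ∀ s → a ≤ s → s < b → CycleEdge cyc (at P s) (at P (suc s))
    vert≡ : ∀ (j : Fin (3 + m cyc)) → vert cyc j ≡ at P (a + toℕ j)
    bound : ∀ (j : Fin (3 + m cyc)) → a + toℕ j ≤ b
    length≡ : 2 + m cyc ≡ b ∸ a

module _ {G : Graph} where
  closeChord : (P : Path G) (a b : ℕ) → 2 + a ≤ b → b ≤ len P → adj G (at P b) (at P a) ≡ true → ChordCycle P a b
  closeChord P a b 2+a≤b b≤len closing = record
    { cyc = C ; on⇒range = on⇒range ; range⇒on = range⇒on ; edge = edge
    ; vert≡ = λ _ → refl ; bound = bound ; length≡ = ≡.sym span }
    where
    a≤b : a ≤ b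
    a≤b = ℕₚ.≤-trans (ℕₚ.m≤n+m a 2) 2+a≤b
    k : ℕ
    k = b ∸ a ∸ 2
    span : b ∸ a ≡ 2 + k
    span = ≡.sym (ℕₚ.m+[n∸m]≡n (subst (_≤ b ∸ a) (ℕₚ.m+n∸n≡m 2 a) (ℕₚ.∸-monoˡ-≤ a 2+a≤b)))
    within : ∀ {s} → s ≤ 2 + k → a + s ≤ b
    within {s} s≤ = offset≤ a≤b (subst (s ≤_) (≡.sym span) s≤)
    bound : ∀ (j : Fin (3 + k)) → a + toℕ j ≤ b
    bound j = within (ℕₚ.≤-pred (toℕ<n j))
    at-bound : ∀ (j : Fin (3 + k)) → a + toℕ j ≤ len P
    at-bound j = ℕₚ.≤-trans (bound j) b≤len
    consecutive : ∀ j → adj G (at P (a + toℕ j)) (at P (a + toℕ (csuc j))) ≡ true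
    consecutive j with csuc-view j
    ... | inj₁ (lt , q) = subst (λ z → adj G (at P (a + toℕ j)) (at P z) ≡ true)
            (trans (≡.sym (ℕₚ.+-suc a (toℕ j))) (cong (a +_) (≡.sym q)))
            (at-adj P _ (ℕₚ.<-≤-trans (subst (_≤ b) (ℕₚ.+-suc a (toℕ j)) (within (ℕₚ.≤-pred lt))) b≤len))
    ... | inj₂ (last , q) = subst₂ (λ x y → adj G (at P x) (at P y) ≡ true)
            (trans (≡.sym (ℕₚ.m+[n∸m]≡n a≤b)) (cong (a +_) (trans span (≡.sym last))))
            (trans (≡.sym (ℕₚ.+-identityʳ a)) (cong (a +_) (≡.sym q)))
            closing
    C : Cycle G
    C = record
      { m = k ; vert = λ j → at P (a + toℕ j)
      ; inj = λ i j e → toℕ-injective (ℕₚ.+-cancelˡ-≡ a _ _ (at-injective P _ _ (at-bound i) (at-bound j) e))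
      ; edges = consecutive }
    position : ∀ s → a ≤ s → s ≤ b → Fin (3 + k)
    position s a≤s s≤b = fromℕ< (s≤s (subst (s ∸ a ≤_) span (ℕₚ.∸-monoˡ-≤ a s≤b)))
    toℕ-position : ∀ s a≤s s≤b → toℕ (position s a≤s s≤b) ≡ s ∸ a
    toℕ-position s a≤s s≤b = toℕ-fromℕ< _
    at-position : ∀ s a≤s s≤b → a + toℕ (position s a≤s s≤b) ≡ s
    at-position s a≤s s≤b = trans (cong (a +_) (toℕ-position s a≤s s≤b)) (ℕₚ.m+[n∸m]≡n a≤s)
    on⇒range : ∀ x → OnCycle C x → Σ ℕ λ s → a ≤ s × s ≤ b × at P s ≡ x
    on⇒range x (j , e) = a + toℕ j , ℕₚ.m≤m+n a (toℕ j) , bound j , e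
    range⇒on : ∀ s → a ≤ s → s ≤ b → OnCycle C (at P s)
    range⇒on s a≤s s≤b = position s a≤s s≤b , cong (at P) (at-position s a≤s s≤b)
    edge : ∀ s → a ≤ s → s < b → CycleEdge C (at P s) (at P (suc s))
    edge s a≤s s<b = j , inj₁ (cong (at P) (at-position s a≤s s≤b) , cong (at P) next-position)
      where
      s≤b : s ≤ b
      s≤b = ℕₚ.<⇒≤ s<b
      j : Fin (3 + k)
      j = position s a≤s s≤b
      j<last : suc (toℕ j) < 3 + k
      j<last = s≤s (subst (λ x → suc x ≤ 2 + k) (≡.sym (toℕ-position s a≤s s≤b))
        (subst (suc (s ∸ a) ≤_) span (subst (_≤ b ∸ a) (ℕₚ.+-∸-assoc 1 a≤s) (ℕₚ.∸-monoˡ-≤ a s<b))))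
      next-position : a + toℕ (csuc j) ≡ suc s
      next-position = begin
        a + toℕ (csuc j)   ≡⟨ cong (a +_) (toℕ-csuc-< j j<last) ⟩
        a + suc (toℕ j)    ≡⟨ ℕₚ.+-suc a (toℕ j) ⟩
        suc (a + toℕ j)    ≡⟨ cong suc (at-position s a≤s s≤b) ⟩
        suc s              ∎
        where open ≡-Reasoning

  opaque
    chordCycle : (P : Path G) (a b : ℕ) → 2 + a ≤ b → b ≤ len P → adj G (at P b) (at P a) ≡ true → ChordCycle P a b
    chordCycle = closeChord

firstTrue : (f : ℕ → Bool) (k : ℕ) →
  (Σ ℕ λ i → i < k × f i ≡ true × (∀ s → s < i → f s ≡ false)) ⊎ (∀ s → s < k → f s ≡ false)
firstTrue f zero = inj₂ (λ s ())
firstTrue f (suc k) with f 0 in e0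
... | true = inj₁ (0 , s≤s z≤n , e0 , λ s ())
... | false with firstTrue (f ∘ suc) k
...   | inj₁ (i , lt , fi , lw) = inj₁ (suc i , s≤s lt , fi , λ where zero _ → e0 ; (suc s) (s≤s l) → lw s l)
...   | inj₂ lw = inj₂ λ where zero _ → e0 ; (suc s) (s≤s l) → lw s l

module _ {G : Graph} where
  High⇒extraNbr : (C : Cycle G) (j : Fin (3 + m C)) → High G (vert C j) →
    Σ (Fin (size G)) λ w → adj G (vert C j) w ≡ true × w ≢ prev C j × w ≢ next C j
  High⇒extraNbr C j h with Finₚ.any? (λ w → (adj G (vert C j) w Data.Bool.≟ true) ×-dec (¬? (w Finₚ.≟ prev C j) ×-dec ¬? (w Finₚ.≟ next C j)))
  ... | yes r = r
  ... | no none = ⊥-elim (ℕₚ.≤⇒≯ (count≤2 (adj G (vert C j)) (λ x → x) (prev C j) (next C j) (λ _ _ e → e) prev⊎next) h)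
    where
    prev⊎next : ∀ x → adj G (vert C j) x ≡ true → x ≡ prev C j ⊎ x ≡ next C j
    prev⊎next x a with x Finₚ.≟ prev C j | x Finₚ.≟ next C j
    ... | yes e | _ = inj₁ e
    ... | no _ | yes e = inj₂ e
    ... | no e₁ | no e₂ = ⊥-elim (none (x , a , e₁ , e₂))

  chordCycles-confined : CyclesShareNoEdge G → (P : Path G) {a₁ b₁ a₂ b₂ : ℕ} →
    ChordCycle P a₁ b₁ → ChordCycle P a₂ b₂ → b₁ ≤ len P → b₂ ≤ len P →
    ∀ s → a₁ ≤ s → s < b₁ → a₂ ≤ s → s < b₂ → ∀ r → a₁ ≤ r → r ≤ b₁ → ¬ (r < a₂ ⊎ b₂ < r)
  chordCycles-confined share P S₁ S₂ b₁≤len b₂≤len s a₁≤s s<b₁ a₂≤s s<b₂ r a₁≤r r≤b₁ out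
    with ChordCycle.on⇒range S₂ (at P r)
           (sharedEdge⇒OnCycle⊆ share (ChordCycle.cyc S₁) (ChordCycle.cyc S₂) (ChordCycle.edge S₁ s a₁≤s s<b₁)
             (ChordCycle.edge S₂ s a₂≤s s<b₂) (at P r) (ChordCycle.range⇒on S₁ r a₁≤r r≤b₁))
  ... | (r′ , a₂≤r′ , r′≤b₂ , e) with at-injective P r′ r (ℕₚ.≤-trans r′≤b₂ b₂≤len) (ℕₚ.≤-trans r≤b₁ b₁≤len) e
  ... | refl with out
  ...   | inj₁ r<a₂ = ℕₚ.<⇒≱ r<a₂ a₂≤r′
  ...   | inj₂ b₂<r = ℕₚ.<⇒≱ b₂<r r′≤b₂

PendantOrLeafCycle : Graph → Set
PendantOrLeafCycle G = PendantEdge G ⊎ Σ (Cycle G) (λ C → highDegreeCount C ≤ 1)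

module Search {G : Graph} (share : CyclesShareNoEdge G) where
  MoreHigh : Path G → Set
  MoreHigh P = Σ (Path G) λ P′ → 1 ≤ len P′ × highCount P < highCount P′

  Progress : Path G → Set
  Progress P = PendantOrLeafCycle G ⊎ MoreHigh P

  -- The path  r₀ … r_lowEnd  p_i p_{i+1} … p_len : a low detour glued to the tail of P.
  record LowDetour (P : Path G) (i : ℕ) : Set where
    field
      detour : Path G
      lowEnd : ℕ
      low : ∀ s → s < suc lowEnd → highᵇ G (at detour s) ≡ false
      offPath : ¬ OnPath P (at detour lowEnd)
      tail≡ : ∀ s → at detour (suc lowEnd + s) ≡ at P (i + s)
      len≡ : len detour ≡ suc lowEnd + (len P ∸ i)
      highCount≡ : highCount detour ≡ highCount P

  module ChordAt (P : Path G) (q : ℕ) (2≤q : 2 ≤ q) (q≤len : q ≤ len P) (closing : adj G (at P q) (at P 0) ≡ true) where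
    S : ChordCycle P 0 q
    S = chordCycle P 0 q 2≤q q≤len closing
    C : Cycle G
    C = ChordCycle.cyc S

    allLow⇒leaf : (∀ s → s < q → highᵇ G (at P s) ≡ false) → highDegreeCount C ≤ 1
    allLow⇒leaf allLow = count≤1 _ (λ x y hx hy → toℕ-injective (trans (high⇒last x hx) (≡.sym (high⇒last y hy))))
      where
      high⇒last : ∀ x → highᵇ G (vert C x) ≡ true → toℕ x ≡ q
      high⇒last x hx with ℕₚ.m≤n⇒m<n∨m≡n (ChordCycle.bound S x)
      ... | inj₂ e = e
      ... | inj₁ lt = ⊥-elim (true≢false (trans (≡.sym hx) (trans (cong (highᵇ G) (ChordCycle.vert≡ S x)) (allLow (toℕ x) lt))))

    module FromHigh (i : ℕ) (i<q : i < q) (high : highᵇ G (at P i) ≡ true) (lowBefore : ∀ s → s < i → highᵇ G (at P s) ≡ false) where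
      i≤len : i ≤ len P
      i≤len = ℕₚ.≤-trans (ℕₚ.<⇒≤ i<q) q≤len

      iC : Fin (3 + m C)
      iC = proj₁ (ChordCycle.range⇒on S i z≤n (ℕₚ.<⇒≤ i<q))
      vert-iC : vert C iC ≡ at P i
      vert-iC = proj₂ (ChordCycle.range⇒on S i z≤n (ℕₚ.<⇒≤ i<q))
      toℕ-iC : toℕ iC ≡ i
      toℕ-iC = at-injective P _ _ (ℕₚ.≤-trans (ChordCycle.bound S iC) q≤len) i≤len (trans (≡.sym (ChordCycle.vert≡ S iC)) vert-iC)

      next-iC : next C iC ≡ at P (suc i)
      next-iC with csuc-view iC
      ... | inj₁ (_ , e) = trans (ChordCycle.vert≡ S (csuc iC)) (cong (at P) (trans e (cong suc toℕ-iC)))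
      ... | inj₂ (e , _) = ⊥-elim (ℕₚ.<-irrefl (trans (≡.sym toℕ-iC) (trans e (ChordCycle.length≡ S))) i<q)

      prev-iC : (i ≡ 0 × prev C iC ≡ at P q) ⊎ (Σ ℕ λ i′ → i ≡ suc i′ × prev C iC ≡ at P i′)
      prev-iC with cpred-view iC
      ... | inj₁ (e , e′) = inj₁ (trans (≡.sym toℕ-iC) e , trans (ChordCycle.vert≡ S (cpred iC)) (cong (at P) (trans e′ (ChordCycle.length≡ S))))
      ... | inj₂ e = inj₂ (toℕ (cpred iC) , trans (≡.sym toℕ-iC) e , ChordCycle.vert≡ S (cpred iC))

      extra = High⇒extraNbr C iC (subst (High G) (≡.sym vert-iC) (highᵇ⇒High G (at P i) high))
      w : Fin (size G)
      w = proj₁ extra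
      pᵢ~w : adj G (at P i) w ≡ true
      pᵢ~w = subst (λ z → adj G z w ≡ true) vert-iC (proj₁ (proj₂ extra))
      w≢prev : w ≢ prev C iC
      w≢prev = proj₁ (proj₂ (proj₂ extra))
      w≢next : w ≢ next C iC
      w≢next = proj₂ (proj₂ (proj₂ extra))

      -- An edge from p_i to another p_l would close a second chord cycle through an edge of C
      -- but with a different vertex range.
      w∉P : ¬ OnPath P w
      w∉P (l , l≤len , pₗ≡w) with ℕₚ.<-cmp l i
      ... | Tri.tri≈ _ refl _ = true≢false (trans (≡.sym pᵢ~pₗ) (irrefl G (at P i)))
        where
        pᵢ~pₗ : adj G (at P i) (at P l) ≡ true
        pᵢ~pₗ = trans (cong (adj G (at P i)) pₗ≡w) pᵢ~w
      ... | Tri.tri> _ _ i<l = compare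
        where
        pᵢ~pₗ : adj G (at P i) (at P l) ≡ true
        pᵢ~pₗ = trans (cong (adj G (at P i)) pₗ≡w) pᵢ~w
        suc-i≢l : suc i ≢ l
        suc-i≢l e = w≢next (trans (≡.sym pₗ≡w) (trans (cong (at P) (≡.sym e)) (≡.sym next-iC)))
        F = chordCycle P i l (ℕₚ.≤∧≢⇒< i<l suc-i≢l) l≤len (trans (sym G (at P l) (at P i)) pᵢ~pₗ)
        l≤q⇒⊥ : l ≤ q → ⊥
        l≤q⇒⊥ l≤q with prev-iC
        ... | inj₁ (_ , prev≡q) = chordCycles-confined share P S F q≤len l≤len i z≤n i<q ℕₚ.≤-refl i<l q z≤n ℕₚ.≤-refl (inj₂ (ℕₚ.≤∧≢⇒< l≤q l≢q))
          where
          l≢q : l ≢ q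
          l≢q e = w≢prev (trans (≡.sym pₗ≡w) (trans (cong (at P) e) (≡.sym prev≡q)))
        ... | inj₂ (i′ , i≡suc , _) = chordCycles-confined share P S F q≤len l≤len i z≤n i<q ℕₚ.≤-refl i<l 0 z≤n z≤n (inj₁ (subst (0 <_) (≡.sym i≡suc) (s≤s z≤n)))
        compare : ⊥
        compare with ℕₚ.<-cmp q l
        ... | Tri.tri< q<l _ _ = chordCycles-confined share P F S l≤len q≤len i ℕₚ.≤-refl i<l z≤n i<q l (ℕₚ.<⇒≤ i<l) ℕₚ.≤-refl (inj₂ q<l)
        ... | Tri.tri≈ _ q≡l _ = l≤q⇒⊥ (ℕₚ.≤-reflexive (≡.sym q≡l))
        ... | Tri.tri> _ _ l<q = l≤q⇒⊥ (ℕₚ.<⇒≤ l<q)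
      ... | Tri.tri< l<i _ _ with prev-iC
      ...   | inj₁ (refl , _) = ℕₚ.n≮0 l<i
      ...   | inj₂ (i′ , refl , prev≡i′) = chordCycles-confined share P S F q≤len i≤len i′ z≤n (ℕₚ.<-trans (ℕₚ.n<1+n i′) i<q) l≤i′ (ℕₚ.n<1+n i′) q z≤n ℕₚ.≤-refl (inj₂ i<q)
        where
        pᵢ~pₗ : adj G (at P i) (at P l) ≡ true
        pᵢ~pₗ = trans (cong (adj G (at P i)) pₗ≡w) pᵢ~w
        l≢i′ : l ≢ i′
        l≢i′ e = w≢prev (trans (≡.sym pₗ≡w) (trans (cong (at P) e) (≡.sym prev≡i′)))
        l<i′ : l < i′
        l<i′ = ℕₚ.≤∧≢⇒< (ℕₚ.≤-pred l<i) l≢i′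
        l≤i′ : l ≤ i′
        l≤i′ = ℕₚ.<⇒≤ l<i′
        F = chordCycle P l (suc i′) (s≤s l<i′) i≤len pᵢ~pₗ

      D : Path G
      D = dropPath P i i≤len
      w∉D : ¬ OnPath D w
      w∉D (s , s≤ , e) = w∉P (i + s , offset≤ i≤len s≤ , e)
      w~D : adj G w (at D 0) ≡ true
      w~D = trans (cong (adj G w ∘ at P) (ℕₚ.+-identityʳ i)) (trans (sym G w (at P i)) pᵢ~w)
      highCount-D : highCount P ≡ highCount D
      highCount-D = countBelow-drop (highᵇ G ∘ at P) i (len P) lowBefore i≤len

      extendDetour : (fuel : ℕ) → (st : LowDetour P i) → size G ≤ len (LowDetour.detour st) + fuel → Progress P
      extendDetour zero st bound = ⊥-elim (ℕₚ.<⇒≱ (len<size (LowDetour.detour st)) (subst (size G ≤_) (ℕₚ.+-identityʳ _) bound))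
      extendDetour (suc f) st bound = continue (headCase detour (subst (1 ≤_) (≡.sym len≡) (s≤s z≤n)))
        where
        open LowDetour st
        continue : HeadCase detour → Progress P
        continue (extend y y∉R y~R) with High? G y
        ... | yes h = inj₂ (consPath detour y y∉R y~R , s≤s z≤n ,
                        subst (λ z → highCount P < bit z + highCount detour) (≡.sym (High⇒highᵇ G y h))
                          (s≤s (ℕₚ.≤-reflexive (≡.sym highCount≡))))
        ... | no ¬h = extendDetour f st′ (subst (size G ≤_) (ℕₚ.+-suc (len detour) f) bound)
          where
          st′ : LowDetour P i
          st′ = record
            { detour = consPath detour y y∉R y~R ; lowEnd = suc lowEnd
            ; low = λ where zero _ → ¬High⇒highᵇ G y ¬h ; (suc s) (s≤s l) → low s l
            ; offPath = offPath ; tail≡ = tail≡ ; len≡ = cong suc len≡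
            ; highCount≡ = subst (λ z → bit z + highCount detour ≡ highCount P) (≡.sym (¬High⇒highᵇ G y ¬h)) highCount≡ }
        continue (pendant pe) = inj₁ (inj₁ pe)
        continue (chord q′ 2≤q′ q′≤len closing′) with q′ ℕₚ.≤? suc lowEnd
        ... | yes q′≤joint = inj₁ (inj₂ (ChordCycle.cyc E , count≤1 _ (λ x y hx hy → toℕ-injective (trans (high⇒joint x hx) (≡.sym (high⇒joint y hy))))))
          where
          E = chordCycle detour 0 q′ 2≤q′ q′≤len closing′
          high⇒joint : ∀ x → highᵇ G (vert (ChordCycle.cyc E) x) ≡ true → toℕ x ≡ suc lowEnd
          high⇒joint x hx with ℕₚ.m≤n⇒m<n∨m≡n (ℕₚ.≤-trans (ChordCycle.bound E x) q′≤joint)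
          ... | inj₂ e = e
          ... | inj₁ lt = ⊥-elim (true≢false (trans (≡.sym hx) (trans (cong (highᵇ G) (ChordCycle.vert≡ E x)) (low (toℕ x) lt))))
        -- The cycle closed on the detour contains the edge p_i p_{i+1} of C, hence all its
        -- vertices lie on C ⊆ P; but it also contains the off-path vertex r_lowEnd.
        ... | no q′≰joint = ⊥-elim (offPath (s , ℕₚ.≤-trans s≤q q≤len , pₛ≡r))
          where
          E = chordCycle detour 0 q′ 2≤q′ q′≤len closing′
          joint<q′ : suc lowEnd < q′
          joint<q′ = ℕₚ.≰⇒> q′≰joint
          r≡pᵢ : at detour (suc lowEnd) ≡ at P i
          r≡pᵢ = trans (cong (at detour) (≡.sym (ℕₚ.+-identityʳ (suc lowEnd)))) (trans (tail≡ 0) (cong (at P) (ℕₚ.+-identityʳ i)))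
          r≡pᵢ₊₁ : at detour (suc (suc lowEnd)) ≡ at P (suc i)
          r≡pᵢ₊₁ = trans (cong (at detour) (≡.sym (ℕₚ.+-comm (suc lowEnd) 1))) (trans (tail≡ 1) (cong (at P) (ℕₚ.+-comm i 1)))
          sharedEdge : CycleEdge (ChordCycle.cyc E) (at P i) (at P (suc i))
          sharedEdge = subst₂ (CycleEdge (ChordCycle.cyc E)) r≡pᵢ r≡pᵢ₊₁ (ChordCycle.edge E (suc lowEnd) z≤n joint<q′)
          onC : OnCycle C (at detour lowEnd)
          onC = sharedEdge⇒OnCycle⊆ share (ChordCycle.cyc E) C sharedEdge (ChordCycle.edge S i z≤n i<q) (at detour lowEnd)
                  (ChordCycle.range⇒on E lowEnd z≤n (ℕₚ.≤-trans (ℕₚ.n≤1+n lowEnd) (ℕₚ.<⇒≤ joint<q′)))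
          s : ℕ
          s = proj₁ (ChordCycle.on⇒range S (at detour lowEnd) onC)
          s≤q : s ≤ q
          s≤q = proj₁ (proj₂ (proj₂ (ChordCycle.on⇒range S (at detour lowEnd) onC)))
          pₛ≡r : at P s ≡ at detour lowEnd
          pₛ≡r = proj₂ (proj₂ (proj₂ (ChordCycle.on⇒range S (at detour lowEnd) onC)))

      progress : Progress P
      progress with High? G w
      ... | yes h = inj₂ (consPath D w w∉D w~D , s≤s z≤n ,
                      subst (λ z → highCount P < bit z + highCount D) (≡.sym (High⇒highᵇ G w h)) (s≤s (ℕₚ.≤-reflexive highCount-D)))
      ... | no ¬h = extendDetour (size G) start (ℕₚ.m≤n+m (size G) _)
        where
        start : LowDetour P i
        start = record
          { detour = consPath D w w∉D w~D ; lowEnd = 0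
          ; low = λ where zero _ → ¬High⇒highᵇ G w ¬h ; (suc s) (s≤s ())
          ; offPath = w∉P ; tail≡ = λ s → refl ; len≡ = refl
          ; highCount≡ = subst (λ z → bit z + highCount D ≡ highCount P) (≡.sym (¬High⇒highᵇ G w ¬h)) (≡.sym highCount-D) }

    progress : Progress P
    progress with firstTrue (highᵇ G ∘ at P) q
    ... | inj₂ allLow = inj₁ (inj₂ (C , allLow⇒leaf allLow))
    ... | inj₁ (i , i<q , high , lowBefore) = FromHigh.progress i i<q high lowBefore

  -- The lexicographic order on (highCount P , len P), since len P < size G.
  potential : Path G → ℕ
  potential P = highCount P * suc (size G) + len P

  potentialBound : ℕ
  potentialBound = size G * suc (size G) + size G

  potential≤bound : ∀ (P : Path G) → potential P ≤ potentialBound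
  potential≤bound P = ℕₚ.+-mono-≤ (ℕₚ.*-monoˡ-≤ (suc (size G)) (highCount≤size P)) (ℕₚ.<⇒≤ (len<size P))

  potential-extend : ∀ P w w∉P w~P → potential P < potential (consPath P w w∉P w~P)
  potential-extend P w w∉P w~P = subst (potential P <_) (≡.sym (ℕₚ.+-suc _ (len P)))
    (s≤s (ℕₚ.+-monoˡ-≤ (len P) (ℕₚ.*-monoˡ-≤ (suc (size G)) (ℕₚ.m≤n+m (highCount P) (bit (highᵇ G w))))))

  potential-moreHigh : ∀ P P′ → highCount P < highCount P′ → potential P < potential P′
  potential-moreHigh P P′ lt = begin-strict
    highCount P * suc (size G) + len P      <⟨ ℕₚ.+-monoʳ-< (highCount P * suc (size G)) (ℕₚ.<-≤-trans (len<size P) (ℕₚ.n≤1+n _)) ⟩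
    highCount P * suc (size G) + suc (size G) ≡⟨ ℕₚ.+-comm (highCount P * suc (size G)) (suc (size G)) ⟩
    suc (highCount P) * suc (size G)        ≤⟨ ℕₚ.*-monoˡ-≤ (suc (size G)) lt ⟩
    highCount P′ * suc (size G)             ≤⟨ ℕₚ.m≤m+n _ (len P′) ⟩
    potential P′                            ∎
    where open ℕₚ.≤-Reasoning

  fuel-step : ∀ P P′ f → potential P < potential P′ →
    potentialBound < potential P + suc f → potentialBound < potential P′ + f
  fuel-step P P′ f lt bound =
    ℕₚ.≤-trans (subst (suc potentialBound ≤_) (ℕₚ.+-suc (potential P) f) bound) (ℕₚ.+-monoˡ-≤ f lt)

  search : (fuel : ℕ) (P : Path G) → 1 ≤ len P → potentialBound < potential P + fuel → PendantOrLeafCycle G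
  search zero P _ bound = ⊥-elim (ℕₚ.<⇒≱ (subst (potentialBound <_) (ℕₚ.+-identityʳ _) bound) (potential≤bound P))
  search (suc f) P 1≤len bound with headCase P 1≤len
  ... | extend w w∉P w~P =
          search f (consPath P w w∉P w~P) (s≤s z≤n) (fuel-step P (consPath P w w∉P w~P) f (potential-extend P w w∉P w~P) bound)
  ... | pendant pe = inj₁ pe
  ... | chord q 2≤q q≤len closing with ChordAt.progress P q 2≤q q≤len closing
  ...   | inj₁ done = done
  ...   | inj₂ (P′ , 1≤len′ , more) = search f P′ 1≤len′ (fuel-step P P′ f (potential-moreHigh P P′ more) bound)

singletonPath : ∀ {G} → Fin (size G) → Path G
singletonPath v = record
  { len = 0 ; at = λ _ → v
  ; at-injective = λ { zero zero _ _ _ → refl }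
  ; at-adj = λ _ () }

pendant⊎leafCycle : ∀ {G} → CyclesShareNoEdge G → ∀ u v → adj G u v ≡ true → PendantOrLeafCycle G
pendant⊎leafCycle {G} share u v u~v =
  search (suc potentialBound) edgePath (s≤s z≤n) (ℕₚ.m≤n+m (suc potentialBound) (potential edgePath))
  where
  open Search share
  u∉v : ¬ OnPath (singletonPath {G} v) u
  u∉v (_ , _ , refl) = true≢false (trans (≡.sym u~v) (irrefl G u))
  edgePath : Path G
  edgePath = consPath (singletonPath v) u u∉v u~v

module Extension (G : Graph) (k : ℕ) (oldNew : Fin (size G) → Fin k → Bool) (newNew : Fin k → Fin k → Bool)
           (newNew-sym : ∀ a b → newNew a b ≡ newNew b a) (newNew-irrefl : ∀ a → newNew a a ≡ false) where
  n : ℕ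
  n = size G

  adj⊎ : Fin n ⊎ Fin k → Fin n ⊎ Fin k → Bool
  adj⊎ (inj₁ a) (inj₁ b) = adj G a b
  adj⊎ (inj₁ a) (inj₂ j) = oldNew a j
  adj⊎ (inj₂ j) (inj₁ a) = oldNew a j
  adj⊎ (inj₂ j) (inj₂ j') = newNew j j'
  adj⊎-sym : ∀ x y → adj⊎ x y ≡ adj⊎ y x
  adj⊎-sym (inj₁ a) (inj₁ b) = sym G a b
  adj⊎-sym (inj₁ a) (inj₂ j) = refl
  adj⊎-sym (inj₂ j) (inj₁ a) = refl
  adj⊎-sym (inj₂ j) (inj₂ j') = newNew-sym j j'
  adj⊎-irrefl : ∀ x → adj⊎ x x ≡ false
  adj⊎-irrefl (inj₁ a) = irrefl G a
  adj⊎-irrefl (inj₂ j) = newNew-irrefl j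

  X : Graph
  X = record { size = n + k ; adj = λ x y → adj⊎ (splitAt n x) (splitAt n y)
    ; sym = λ x y → adj⊎-sym (splitAt n x) (splitAt n y)
    ; irrefl = λ x → adj⊎-irrefl (splitAt n x) }

  old : Fin n → Fin (n + k)
  old a = a ↑ˡ k
  new : Fin k → Fin (n + k)
  new j = n ↑ʳ j

  adj-old-old : ∀ a b → adj X (old a) (old b) ≡ adj G a b
  adj-old-old a b rewrite Finₚ.splitAt-↑ˡ n a k | Finₚ.splitAt-↑ˡ n b k = refl
  adj-old-new : ∀ a j → adj X (old a) (new j) ≡ oldNew a j
  adj-old-new a j rewrite Finₚ.splitAt-↑ˡ n a k | Finₚ.splitAt-↑ʳ n k j = refl
  adj-new-old : ∀ j a → adj X (new j) (old a) ≡ oldNew a j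
  adj-new-old j a rewrite Finₚ.splitAt-↑ˡ n a k | Finₚ.splitAt-↑ʳ n k j = refl
  adj-new-new : ∀ j j' → adj X (new j) (new j') ≡ newNew j j'
  adj-new-new j j' rewrite Finₚ.splitAt-↑ʳ n k j | Finₚ.splitAt-↑ʳ n k j' = refl

  ι : Embedding G X
  ι = record { fun = old ; injective = λ a b e → Finₚ.↑ˡ-injective k a b e ; adj-pres = adj-old-old }

  old⊎new : ∀ x → (Σ (Fin n) λ a → old a ≡ x) ⊎ (Σ (Fin k) λ j → new j ≡ x)
  old⊎new x with splitAt n x in e
  ... | inj₁ a = inj₁ (a , Finₚ.splitAt⁻¹-↑ˡ e)
  ... | inj₂ j = inj₂ (j , Finₚ.splitAt⁻¹-↑ʳ e)

  old≢new : ∀ a j → old a ≢ new j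
  old≢new a j e with trans (≡.sym (Finₚ.splitAt-↑ˡ n a k)) (trans (cong (splitAt n) e) (Finₚ.splitAt-↑ʳ n k j))
  ... | ()

  new-injective : ∀ j j' → new j ≡ new j' → j ≡ j'
  new-injective j j' e = Finₚ.↑ʳ-injective n j j' e

pulledCycles-shareNoEdge : ∀ {Z X} (e : Embedding Z X) → CyclesShareNoEdge Z → (c d : Cycle X) → (pc : InImage e c) → (pd : InImage e d) →
  ∀ {x y} → CycleEdge c x y → CycleEdge d x y → SameCycle c d
pulledCycles-shareNoEdge {Z} {X} e c2 c d pc pd ce de with edge⇒pullCycle-edge e c pc ce | edge⇒pullCycle-edge e d pd de
... | (x' , y' , ex' , ey' , ce') | (x'' , y'' , ex'' , ey'' , de')
  with injective e x' x'' (trans ex' (≡.sym ex'')) | injective e y' y'' (trans ey' (≡.sym ey''))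
... | refl | refl = λ u v → mk⇔ (go c d pc pd (c2 (pullCycle e c pc) (pullCycle e d pd) x' y' ce' de') u v) (go d c pd pc (c2 (pullCycle e d pd) (pullCycle e c pc) x' y' de' ce') u v)
  where
  go : ∀ (c d : Cycle X) (pc : InImage e c) (pd : InImage e d) → SameCycle (pullCycle e c pc) (pullCycle e d pd) →
    ∀ u v → CycleEdge c u v → CycleEdge d u v
  go c d pc pd same u v cu with edge⇒pullCycle-edge e c pc cu
  ... | (u' , v' , eu , ev , cu') = subst₂ (CycleEdge d) eu ev (pullCycle-edge⇒edge e d pd (Equivalence.to (same u' v') cu'))


module TwoLeaves (Z : Graph) (s1 s2 : Fin (size Z)) where
  anchor : Fin 2 → Fin (size Z)
  anchor Fin.zero = s1
  anchor (Fin.suc _) = s2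
  leafEdge : Fin (size Z) → Fin 2 → Bool
  leafEdge a j = does (a Finₚ.≟ anchor j)
  open Extension Z 2 leafEdge (λ _ _ → false) (λ _ _ → refl) (λ _ → refl) public

  leafEdge⇒anchor : ∀ a j → leafEdge a j ≡ true → a ≡ anchor j
  leafEdge⇒anchor a j e with a Finₚ.≟ anchor j
  ... | yes p = p
  ... | no _ = ⊥-elim (true≢false (≡.sym e))

  leafEdge-anchor : ∀ j → leafEdge (anchor j) j ≡ true
  leafEdge-anchor j with anchor j Finₚ.≟ anchor j
  ... | yes _ = refl
  ... | no ne = ⊥-elim (ne refl)

  leaf-nbr : ∀ j y → adj X (new j) y ≡ true → y ≡ old (anchor j)
  leaf-nbr j y a with old⊎new y
  ... | inj₁ (b , refl) = cong old (leafEdge⇒anchor b j (trans (≡.sym (adj-new-old j b)) a))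
  ... | inj₂ (j' , refl) = ⊥-elim (true≢false (trans (≡.sym a) (adj-new-new j j')))

  old-cycle : ∀ (c : Cycle X) → InImage ι c
  old-cycle c i with old⊎new (vert c i)
  ... | inj₁ (a , e) = a , e
  ... | inj₂ (j , e) = ⊥-elim (prev≢next c i (trans (leaf-nbr j _ (subst (λ z → adj X z _ ≡ true) (≡.sym e) (adj-prev c i)))
                                        (≡.sym (leaf-nbr j _ (subst (λ z → adj X z _ ≡ true) (≡.sym e) (adj-next c i))))))

  degree-unchanged : ∀ w → w ≢ s1 → w ≢ s2 → degree X (old w) ≡ degree Z w
  degree-unchanged w n1 n2 = degree-reflect ι w nb
    where
    nb : ∀ y → adj X (old w) y ≡ true → ∃ λ y' → old y' ≡ y
    nb y a with old⊎new y
    ... | inj₁ r = r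
    ... | inj₂ (Fin.zero , refl) = ⊥-elim (n1 (leafEdge⇒anchor w Fin.zero (trans (≡.sym (adj-old-new w Fin.zero)) a)))
    ... | inj₂ (Fin.suc Fin.zero , refl) = ⊥-elim (n2 (leafEdge⇒anchor w (Fin.suc Fin.zero) (trans (≡.sym (adj-old-new w (Fin.suc Fin.zero))) a)))

  anchor-high : ∀ j p q → p ≢ q → adj Z (anchor j) p ≡ true → adj Z (anchor j) q ≡ true → High X (old (anchor j))
  anchor-high j p q pq ap aq = 3≤count (adj X (old (anchor j)))
    (λ e → pq (injective ι p q e)) (old≢new p j) (old≢new q j)
    (trans (adj-old-old _ p) ap) (trans (adj-old-old _ q) aq) (trans (adj-old-new _ j) (leafEdge-anchor j))

module _ (A : ℕ → Set) where
  -- A cycle through an anchor that was low in Z shares an edge with C and so lies on C,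
  -- where only the anchors can be high after adding the leaves; any other cycle keeps
  -- the highness of each of its vertices.
  twoLeaves∈GA : (Z : Graph) → InGA A Z → (C : Cycle Z) (t₁ t₂ : Fin (3 + m C)) →
    (∀ i → High Z (vert C i) → i ≡ t₁) → InGA A (TwoLeaves.X Z (vert C t₁) (vert C t₂))
  twoLeaves∈GA Z (lengths∈A , share , ≤2high) C t₁ t₂ onlyHigh = lengths∈A ∘ pulled , shareNoEdge , ≤2high′
    where
    open TwoLeaves Z (vert C t₁) (vert C t₂)
    pulled : Cycle X → Cycle Z
    pulled c = pullCycle ι c (old-cycle c)
    pulled-vert : ∀ c i → old (vert (pulled c) i) ≡ vert c i
    pulled-vert c = pullCycle-vert ι c (old-cycle c)
    shareNoEdge : CyclesShareNoEdge X
    shareNoEdge c d u v = pulledCycles-shareNoEdge ι share c d (old-cycle c) (old-cycle d)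
    ≤2high′ : ∀ c → highDegreeCount c ≤ 2
    ≤2high′ c with Finₚ.any? (λ i → ((vert (pulled c) i Finₚ.≟ vert C t₁) ⊎-dec (vert (pulled c) i Finₚ.≟ vert C t₂)) ×-dec ¬? (High? Z (vert (pulled c) i)))
    ... | no none = subst (_≤ 2) (≡.sym (count-cong highᵇ-same)) (≤2high (pulled c))
      where
      highᵇ-same : ∀ i → highᵇ X (vert c i) ≡ highᵇ Z (vert (pulled c) i)
      highᵇ-same i with vert (pulled c) i Finₚ.≟ vert C t₁ | vert (pulled c) i Finₚ.≟ vert C t₂ | High? Z (vert (pulled c) i)
      ... | _ | _ | yes h = trans (High⇒highᵇ X (vert c i) (subst (High X) (pulled-vert c i) (High-mono ι _ h))) (≡.sym (High⇒highᵇ Z _ h))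
      ... | yes e₁ | _ | no ¬h = ⊥-elim (none (i , inj₁ e₁ , ¬h))
      ... | no _ | yes e₂ | no ¬h = ⊥-elim (none (i , inj₂ e₂ , ¬h))
      ... | no ≢₁ | no ≢₂ | no _ = subst (λ z → highᵇ X z ≡ highᵇ Z (vert (pulled c) i)) (pulled-vert c i) (cong (2 <ᵇ_) (degree-unchanged _ ≢₁ ≢₂))
    ... | yes (i₀ , atAnchor , low) = count≤2 _ (vert c) (old (vert C t₁)) (old (vert C t₂)) (inj c) highOnlyAnchors
      where
      c′ = pulled c
      anchorIndex : Σ (Fin (3 + m C)) λ t → vert C t ≡ vert c′ i₀
      anchorIndex = [ (λ e → t₁ , ≡.sym e) , (λ e → t₂ , ≡.sym e) ]′ atAnchor
      t = proj₁ anchorIndex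
      sharedEdge : CycleEdge C (vert c′ i₀) (next c′ i₀)
      sharedEdge = subst (λ z → CycleEdge C z (next c′ i₀)) (proj₂ anchorIndex)
        (lowDegree-cycleEdge C t _ (subst (λ z → degree Z z ≤ 2) (≡.sym (proj₂ anchorIndex)) (ℕₚ.≮⇒≥ low))
          (subst (λ z → adj Z z (next c′ i₀) ≡ true) (≡.sym (proj₂ anchorIndex)) (adj-next c′ i₀)))
      highOnlyAnchors : ∀ i → highᵇ X (vert c i) ≡ true → vert c i ≡ old (vert C t₁) ⊎ vert c i ≡ old (vert C t₂)
      highOnlyAnchors i high with sharedEdge⇒OnCycle⊆ share c′ C (cycleEdge-next c′ i₀) sharedEdge (vert c′ i) (i , refl)
      ... | (j , ej) with j Finₚ.≟ t₁ | j Finₚ.≟ t₂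
      ... | yes refl | _ = inj₁ (trans (≡.sym (pulled-vert c i)) (cong old (≡.sym ej)))
      ... | no _ | yes refl = inj₂ (trans (≡.sym (pulled-vert c i)) (cong old (≡.sym ej)))
      ... | no j≢t₁ | no j≢t₂ = ⊥-elim (j≢t₁ (onlyHigh j (subst (3 ≤_) degree≡ highX)))
        where
        degree≡ : degree X (old (vert C j)) ≡ degree Z (vert C j)
        degree≡ = degree-unchanged _ (λ e → j≢t₁ (inj C j t₁ e)) (λ e → j≢t₂ (inj C j t₂ e))
        highX : High X (old (vert C j))
        highX = subst (High X) (trans (≡.sym (pulled-vert c i)) (cong old (≡.sym ej))) (highᵇ⇒High X _ high)

-- New vertices n₀ … n_{K'} joined into the path v n₀ … n_{K'} u, which closes the edge uv
-- of Z into the cycle u v n₀ … n_{K'} of length 3 + K'.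
module Thread (Z : Graph) (u v : Fin (size Z)) (K' : ℕ) where
  K : ℕ
  K = suc K'
  EndEdge : Fin (size Z) → Fin K → Set
  EndEdge a j = (a ≡ v × toℕ j ≡ 0) ⊎ (a ≡ u × suc (toℕ j) ≡ K)
  endEdge? : ∀ a j → Dec (EndEdge a j)
  endEdge? a j = ((a Finₚ.≟ v) ×-dec (toℕ j ℕₚ.≟ 0)) ⊎-dec ((a Finₚ.≟ u) ×-dec (suc (toℕ j) ℕₚ.≟ K))
  endEdgeᵇ : Fin (size Z) → Fin K → Bool
  endEdgeᵇ a j = does (endEdge? a j)
  Consecutive : Fin K → Fin K → Set
  Consecutive j j' = suc (toℕ j) ≡ toℕ j' ⊎ suc (toℕ j') ≡ toℕ j
  consecutive? : ∀ j j' → Dec (Consecutive j j')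
  consecutive? j j' = (suc (toℕ j) ℕₚ.≟ toℕ j') ⊎-dec (suc (toℕ j') ℕₚ.≟ toℕ j)
  consecutiveᵇ : Fin K → Fin K → Bool
  consecutiveᵇ j j' = does (consecutive? j j')
  consecutiveᵇ-sym : ∀ a b → consecutiveᵇ a b ≡ consecutiveᵇ b a
  consecutiveᵇ-sym a b = does-⇔ (mk⇔ swap swap) (consecutive? a b) (consecutive? b a)
  consecutiveᵇ-irrefl : ∀ a → consecutiveᵇ a a ≡ false
  consecutiveᵇ-irrefl a = dec-false (consecutive? a a) λ where (inj₁ e) → ℕₚ.1+n≢n e ; (inj₂ e) → ℕₚ.1+n≢n e
  open Extension Z K endEdgeᵇ consecutiveᵇ consecutiveᵇ-sym consecutiveᵇ-irrefl public

  module ThroughPendant (u≢v : u ≢ v) (u~v : adj Z u v ≡ true) (onlyNbr : ∀ y → adj Z v y ≡ true → y ≡ u) where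
    threadVertex : ℕ → Fin (n + K)
    threadVertex s with s ℕₚ.<? K
    ... | yes lt = new (fromℕ< lt)
    ... | no _ = old u

    threadVertex-< : ∀ s (lt : s < K) → threadVertex s ≡ new (fromℕ< lt)
    threadVertex-< s lt with s ℕₚ.<? K
    ... | yes _ = refl
    ... | no nl = ⊥-elim (nl lt)

    threadVertex-end : threadVertex K ≡ old u
    threadVertex-end with K ℕₚ.<? K
    ... | yes lt = ⊥-elim (ℕₚ.<-irrefl refl lt)
    ... | no _ = refl

    -- loop s is the s-th vertex of that cycle; loop (2 + K) wraps around to u.
    loop : ℕ → Fin (n + K)
    loop zero = old u
    loop (suc zero) = old v
    loop (suc (suc s)) = threadVertex s

    loop-new : ∀ j → loop (2 + toℕ j) ≡ new j
    loop-new j = trans (threadVertex-< (toℕ j) (toℕ<n j)) (cong new (fromℕ<-toℕ j (toℕ<n j)))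

    index< : ∀ s' → 2 + s' ≤ suc K → s' < K
    index< s' (s≤s le) = le

    endEdgeᵇ⇒ : ∀ a j → endEdgeᵇ a j ≡ true → EndEdge a j
    endEdgeᵇ⇒ a j e = does⇒ (endEdge? a j) e
    consecutiveᵇ⇒ : ∀ j j' → consecutiveᵇ j j' ≡ true → Consecutive j j'
    consecutiveᵇ⇒ j j' e = does⇒ (consecutive? j j') e

    loop-adj : ∀ s → s ≤ suc K → adj X (loop s) (loop (suc s)) ≡ true
    loop-adj zero _ = trans (adj-old-old u v) u~v
    loop-adj (suc zero) _ = trans (cong (adj X (old v)) (threadVertex-< 0 (s≤s z≤n))) (trans (adj-old-new v _) (dec-true (endEdge? v (fromℕ< {0} {K} (s≤s z≤n))) (inj₁ (refl , toℕ-fromℕ< {0} {K} (s≤s z≤n)))))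
    loop-adj (suc (suc s')) le with ℕₚ.m≤n⇒m<n∨m≡n (index< s' le)
    ... | inj₁ lt' = trans (cong₂ (adj X) (threadVertex-< s' (index< s' le)) (threadVertex-< (suc s') lt'))
                     (trans (adj-new-new _ _) (dec-true (consecutive? (fromℕ< (index< s' le)) (fromℕ< lt')) (inj₁ (trans (cong suc (toℕ-fromℕ< (index< s' le))) (≡.sym (toℕ-fromℕ< lt'))))))
    ... | inj₂ sK = trans (cong₂ (adj X) (threadVertex-< s' (index< s' le)) nK)
                     (trans (adj-new-old _ u) (dec-true (endEdge? u (fromℕ< (index< s' le))) (inj₂ (refl , trans (cong suc (toℕ-fromℕ< (index< s' le))) sK))))
      where
      nK : threadVertex (suc s') ≡ old u
      nK = trans (cong threadVertex sK) threadVertex-end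

    loop-nbr : ∀ s → 1 ≤ s → s ≤ suc K → ∀ y → adj X (loop s) y ≡ true → y ≡ loop (s ∸ 1) ⊎ y ≡ loop (suc s)
    loop-nbr (suc zero) _ _ y a with old⊎new y
    ... | inj₁ (b , refl) = inj₁ (cong old (onlyNbr b (trans (≡.sym (adj-old-old v b)) a)))
    ... | inj₂ (j , refl) with endEdgeᵇ⇒ v j (trans (≡.sym (adj-old-new v j)) a)
    ...   | inj₁ (_ , j0) = inj₂ (trans (≡.sym (loop-new j)) (cong loop (cong (2 +_) j0)))
    ...   | inj₂ (vu , _) = ⊥-elim (u≢v (≡.sym vu))
    loop-nbr (suc (suc s')) _ le y a with old⊎new y
    ... | inj₁ (b , refl) with endEdgeᵇ⇒ b j (trans (≡.sym (adj-new-old j b)) (subst (λ z → adj X z (old b) ≡ true) (threadVertex-< s' lt) a))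
      where
      lt = index< s' le
      j = fromℕ< lt
    ...   | inj₁ (refl , j0) = inj₁ (cong loop (cong suc (≡.sym (trans (≡.sym (toℕ-fromℕ< (index< s' le))) j0))))
    ...   | inj₂ (refl , jK) = inj₂ (≡.sym (trans (cong threadVertex (trans (cong suc (≡.sym (toℕ-fromℕ< (index< s' le)))) jK)) threadVertex-end))
    loop-nbr (suc (suc s')) _ le y a | inj₂ (j' , refl) with consecutiveᵇ⇒ j j' (trans (≡.sym (adj-new-new j j')) (subst (λ z → adj X z (new j') ≡ true) (threadVertex-< s' lt) a))
      where
      lt = index< s' le
      j = fromℕ< lt
    ... | inj₁ e = inj₂ (trans (≡.sym (loop-new j')) (cong loop (cong (2 +_) (≡.sym (trans (cong suc (≡.sym (toℕ-fromℕ< (index< s' le)))) e)))))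
    ... | inj₂ e = inj₁ (trans (≡.sym (loop-new j')) (cong loop (cong suc (trans e (toℕ-fromℕ< (index< s' le))))))

    loop-injective : ∀ s t → s ≤ suc K → t ≤ suc K → loop s ≡ loop t → s ≡ t
    loop-injective zero zero _ _ _ = refl
    loop-injective zero (suc zero) _ _ e = ⊥-elim (u≢v (injective ι u v e))
    loop-injective (suc zero) zero _ _ e = ⊥-elim (u≢v (injective ι u v (≡.sym e)))
    loop-injective (suc zero) (suc zero) _ _ _ = refl
    loop-injective zero (suc (suc t)) _ lt e = ⊥-elim (old≢new u _ (trans e (threadVertex-< t (index< t lt))))
    loop-injective (suc (suc s)) zero ls _ e = ⊥-elim (old≢new u _ (trans (≡.sym e) (threadVertex-< s (index< s ls))))
    loop-injective (suc zero) (suc (suc t)) _ lt e = ⊥-elim (old≢new v _ (trans e (threadVertex-< t (index< t lt))))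
    loop-injective (suc (suc s)) (suc zero) ls _ e = ⊥-elim (old≢new v _ (trans (≡.sym e) (threadVertex-< s (index< s ls))))
    loop-injective (suc (suc s)) (suc (suc t)) ls lt e = cong (2 +_) (trans (≡.sym (toℕ-fromℕ< (index< s ls)))
      (trans (cong toℕ (new-injective _ _ (trans (≡.sym (threadVertex-< s (index< s ls))) (trans e (threadVertex-< t (index< t lt)))))) (toℕ-fromℕ< (index< t lt))))

    loop-wrap : loop (suc (suc K)) ≡ loop 0
    loop-wrap = threadVertex-end

    threadCycle : Cycle X
    threadCycle = record { m = K' ; vert = λ i → loop (toℕ i) ; inj = ij ; edges = ed }
      where
      le : ∀ (i : Fin (3 + K')) → toℕ i ≤ suc K
      le i = ℕₚ.≤-pred (toℕ<n i)
      ij : ∀ i j → loop (toℕ i) ≡ loop (toℕ j) → i ≡ j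
      ij i j e = toℕ-injective (loop-injective _ _ (le i) (le j) e)
      ed : ∀ i → adj X (loop (toℕ i)) (loop (toℕ (csuc i))) ≡ true
      ed i with csuc-view i
      ... | inj₁ (lt , q) = subst (λ z → adj X (loop (toℕ i)) (loop z) ≡ true) (≡.sym q) (loop-adj (toℕ i) (le i))
      ... | inj₂ (q1 , q2) = subst₂ (λ z z' → adj X (loop z) z' ≡ true) (≡.sym q1) (trans loop-wrap (cong loop (≡.sym q2))) (loop-adj (suc K) ℕₚ.≤-refl)

    OnLoop : Fin (n + K) → Set
    OnLoop x = Σ ℕ λ s → s ≤ suc K × loop s ≡ x

    OnLoop⇒OnThreadCycle : ∀ x → OnLoop x → OnCycle threadCycle x
    OnLoop⇒OnThreadCycle x (s , le , e) = fromℕ< (s≤s le) , trans (cong loop (toℕ-fromℕ< (s≤s le))) e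

    OnThreadCycle⇒OnLoop : ∀ x → OnCycle threadCycle x → OnLoop x
    OnThreadCycle⇒OnLoop x (i , e) = toℕ i , ℕₚ.≤-pred (toℕ<n i) , e

    loop-adj-prev : ∀ s → 1 ≤ s → s ≤ suc K → adj X (loop s) (loop (s ∸ 1)) ≡ true
    loop-adj-prev (suc s) _ le = trans (sym X _ _) (loop-adj s (ℕₚ.≤-trans (ℕₚ.n≤1+n s) le))

    loop-lowDegree : ∀ s → 1 ≤ s → s ≤ suc K → degree X (loop s) ≤ 2
    loop-lowDegree s l1 le = count≤2 (adj X (loop s)) (λ x → x) (loop (s ∸ 1)) (loop (suc s)) (λ _ _ e → e) (loop-nbr s l1 le)

    loop-nbr-onCycle : ∀ (c : Cycle X) s → 1 ≤ s → s ≤ suc K → OnCycle c (loop s) → ∀ y → adj X (loop s) y ≡ true → OnCycle c y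
    loop-nbr-onCycle c s l1 le (a , ea) y ay with lowDegree-nbr c a y (subst (λ z → degree X z ≤ 2) (≡.sym ea) (loop-lowDegree s l1 le)) (subst (λ z → adj X z y ≡ true) (≡.sym ea) ay)
    ... | inj₁ e = cpred a , ≡.sym e
    ... | inj₂ e = csuc a , ≡.sym e

    module Spread (c : Cycle X) (s0 : ℕ) (l0 : 1 ≤ s0) (le0 : s0 ≤ suc K) (on0 : OnCycle c (loop s0)) where
      up : ∀ d → s0 + d ≤ suc K → OnCycle c (loop (s0 + d))
      up zero le = subst (OnCycle c ∘ loop) (≡.sym (ℕₚ.+-identityʳ s0)) on0
      up (suc d) le = subst (OnCycle c ∘ loop) (≡.sym (ℕₚ.+-suc s0 d))
        (loop-nbr-onCycle c (s0 + d) (ℕₚ.≤-trans l0 (ℕₚ.m≤m+n s0 d)) le' (up d le') _ (loop-adj (s0 + d) le'))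
        where
        le' : s0 + d ≤ suc K
        le' = ℕₚ.≤-trans (ℕₚ.≤-trans (ℕₚ.n≤1+n (s0 + d)) (ℕₚ.≤-reflexive (≡.sym (ℕₚ.+-suc s0 d)))) le
      top : OnCycle c (loop (suc K))
      top = subst (OnCycle c ∘ loop) (ℕₚ.m+[n∸m]≡n le0) (up (suc K ∸ s0) (ℕₚ.≤-reflexive (ℕₚ.m+[n∸m]≡n le0)))
      down : ∀ d → d ≤ K → OnCycle c (loop (suc K ∸ d))
      down zero _ = top
      down (suc d) le = subst (OnCycle c ∘ loop) (ℕₚ.pred[m∸n]≡m∸[1+n] (suc K) d)
        (loop-nbr-onCycle c (suc K ∸ d) l1 (ℕₚ.m∸n≤m (suc K) d) (down d (ℕₚ.≤-trans (ℕₚ.n≤1+n d) le)) _ (loop-adj-prev (suc K ∸ d) l1 (ℕₚ.m∸n≤m (suc K) d)))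
        where
        l1 : 1 ≤ suc K ∸ d
        l1 = ℕₚ.m<n⇒0<n∸m (s≤s (ℕₚ.≤-trans (ℕₚ.n≤1+n d) le))
      allOn : ∀ s → s ≤ suc K → OnCycle c (loop s)
      allOn zero _ = loop-nbr-onCycle c 1 (s≤s z≤n) (s≤s z≤n) on1 _ (loop-adj-prev 1 (s≤s z≤n) (s≤s z≤n))
        where
        on1 : OnCycle c (loop 1)
        on1 = subst (OnCycle c ∘ loop) (ℕₚ.m∸[m∸n]≡n {suc K} {1} (s≤s z≤n)) (down (suc K ∸ 1) ℕₚ.≤-refl)
      allOn (suc s) le = subst (OnCycle c ∘ loop) (ℕₚ.m∸[m∸n]≡n le) (down (suc K ∸ suc s) (ℕₚ.∸-monoʳ-≤ {1} {suc s} (suc K) (s≤s z≤n)))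

    module Confine (c : Cycle X) (allOn : ∀ s → s ≤ suc K → OnCycle c (loop s)) where
      cycleNbr-index : ∀ i a s → 1 ≤ s → s ≤ suc K → vert c a ≡ loop s → adj X (loop s) (vert c i) ≡ true → a ≡ csuc i ⊎ a ≡ cpred i
      cycleNbr-index i a s l1 le e ad with lowDegree-nbr c a (vert c i) (subst (λ z → degree X z ≤ 2) (≡.sym e) (loop-lowDegree s l1 le)) (subst (λ z → adj X z (vert c i) ≡ true) (≡.sym e) ad)
      ... | inj₁ q = inj₁ (trans (≡.sym (csuc-cpred a)) (cong csuc (inj c _ _ (≡.sym q))))
      ... | inj₂ q = inj₂ (trans (≡.sym (cpred-csuc a)) (cong cpred (inj c _ _ (≡.sym q))))

      step : ∀ i → OnLoop (vert c i) → OnLoop (vert c (csuc i))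
      step i (suc s' , le , e) with loop-nbr (suc s') (s≤s z≤n) le (vert c (csuc i)) (subst (λ z → adj X z (vert c (csuc i)) ≡ true) (≡.sym e) (edges c i))
      ... | inj₁ q = s' , ℕₚ.≤-trans (ℕₚ.n≤1+n s') le , ≡.sym q
      ... | inj₂ q with ℕₚ.m≤n⇒m<n∨m≡n le
      ...   | inj₁ lt = suc (suc s') , lt , ≡.sym q
      ...   | inj₂ refl = 0 , z≤n , ≡.sym (trans q loop-wrap)
      step i (zero , le , e) = res
        where
        oa = allOn 1 (s≤s z≤n)
        ob = allOn (suc K) ℕₚ.≤-refl
        a = proj₁ oa
        b = proj₁ ob
        ad1 : adj X (loop 1) (vert c i) ≡ true
        ad1 = subst (λ z → adj X (loop 1) z ≡ true) e (loop-adj-prev 1 (s≤s z≤n) (s≤s z≤n))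
        adK : adj X (loop (suc K)) (vert c i) ≡ true
        adK = subst (λ z → adj X (loop (suc K)) z ≡ true) (trans loop-wrap e) (loop-adj (suc K) ℕₚ.≤-refl)
        ab : a ≢ b
        ab q = ℕₚ.1+n≢0 {K'} (≡.sym (ℕₚ.suc-injective (loop-injective 1 (suc K) (s≤s z≤n) ℕₚ.≤-refl (trans (≡.sym (proj₂ oa)) (trans (cong (vert c) q) (proj₂ ob))))))
        res : OnLoop (vert c (csuc i))
        res with cycleNbr-index i a 1 (s≤s z≤n) (s≤s z≤n) (proj₂ oa) ad1 | cycleNbr-index i b (suc K) (s≤s z≤n) ℕₚ.≤-refl (proj₂ ob) adK
        ... | inj₁ q | _ = 1 , s≤s z≤n , trans (≡.sym (proj₂ oa)) (cong (vert c) q)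
        ... | inj₂ q | inj₁ q' = suc K , ℕₚ.≤-refl , trans (≡.sym (proj₂ ob)) (cong (vert c) q')
        ... | inj₂ q | inj₂ q' = ⊥-elim (ab (trans q (≡.sym q')))

module _ (A : ℕ → Set) (Z : Graph) (Z∈ : InGA A Z) (u v : Fin (size Z)) (u≢v : u ≢ v) (u~v : adj Z u v ≡ true)
         (onlyNbr : ∀ y → adj Z v y ≡ true → y ≡ u) (K' : ℕ) (Aℓ : A (3 + K')) where
  open Thread Z u v K'
  open ThroughPendant u≢v u~v onlyNbr
  private
    lengths∈A = proj₁ Z∈
    share = proj₁ (proj₂ Z∈)
    ≤2high = proj₂ (proj₂ Z∈)

  NewCycle : Cycle X → Set
  NewCycle c = Σ (Fin (3 + m c)) λ i0 → Σ (Fin K) λ j0 → new j0 ≡ vert c i0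

  new⊎old-cycle : ∀ (c : Cycle X) → NewCycle c ⊎ InImage ι c
  new⊎old-cycle c with Finₚ.any? (λ i → isNew (vert c i))
    where
    isNew : ∀ x → Dec (Σ (Fin K) λ j → new j ≡ x)
    isNew x with old⊎new x
    ... | inj₁ (a , e) = no λ where (j , e') → old≢new a j (trans e (≡.sym e'))
    ... | inj₂ r = yes r
  ... | yes (i0 , j0 , e) = inj₁ (i0 , j0 , e)
  ... | no none = inj₂ allOld
    where
    allOld : InImage ι c
    allOld i with old⊎new (vert c i)
    ... | inj₁ r = r
    ... | inj₂ (j , e) = ⊥-elim (none (i , j , e))

  -- The vertices of the loop other than u have degree 2, so a cycle through one of them
  -- contains the whole loop and never leaves it: it is the thread cycle.
  module NewCycleFacts (c : Cycle X) (nc : NewCycle c) where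
    i0 = proj₁ nc
    j0 = proj₁ (proj₂ nc)
    s0 = 2 + toℕ j0
    on0 : OnCycle c (loop s0)
    on0 = i0 , trans (≡.sym (proj₂ (proj₂ nc))) (≡.sym (loop-new j0))
    allOn : ∀ s → s ≤ suc K → OnCycle c (loop s)
    allOn = Spread.allOn c s0 (s≤s z≤n) (s≤s (s≤s (ℕₚ.≤-pred (toℕ<n j0)))) on0
    sub : ∀ i → OnLoop (vert c i)
    sub = cycle-induction (OnLoop ∘ vert c) i0 (s0 , s≤s (s≤s (ℕₚ.≤-pred (toℕ<n j0))) , trans (loop-new j0) (proj₂ (proj₂ nc))) (Confine.step c allOn)
    subOn : ∀ z → OnCycle c z → OnLoop z
    subOn z (i , refl) = sub i
    length≡ : 3 + m c ≡ 3 + K'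
    length≡ = ℕₚ.≤-antisym (OnCycle⊆⇒length≤ c threadCycle (λ i → OnLoop⇒OnThreadCycle _ (sub i))) (OnCycle⊆⇒length≤ threadCycle c (λ i → allOn (toℕ i) (ℕₚ.≤-pred (toℕ<n i))))

  transferEdge : ∀ (e1 e2 : Cycle X) → (∀ z → OnCycle e1 z → OnLoop z) → (∀ s → s ≤ suc K → OnCycle e2 (loop s)) →
    ∀ x y → CycleEdge e1 x y → CycleEdge e2 x y
  transferEdge e1 e2 sub1 on2 x y ce with cycleEdge-ends e1 ce
  ... | (ox , oy) with sub1 x ox | sub1 y oy
  ... | (suc s , ls , refl) | _ with on2 (suc s) ls
  ...   | (a , ea) = subst (λ z → CycleEdge e2 z y) ea (lowDegree-cycleEdge e2 a y (subst (λ z → degree X z ≤ 2) (≡.sym ea) (loop-lowDegree (suc s) (s≤s z≤n) ls)) (subst (λ z → adj X z y ≡ true) (≡.sym ea) (cycleEdge-adj e1 ce)))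
  transferEdge e1 e2 sub1 on2 x y ce | (ox , oy) | (zero , ls , refl) | (zero , lt , refl) = ⊥-elim (true≢false (trans (≡.sym (cycleEdge-adj e1 ce)) (irrefl X _)))
  transferEdge e1 e2 sub1 on2 x y ce | (ox , oy) | (zero , ls , refl) | (suc t , lt , refl) with on2 (suc t) lt
  ...   | (a , ea) = cycleEdge-sym e2 (subst (λ z → CycleEdge e2 z x) ea (lowDegree-cycleEdge e2 a x (subst (λ z → degree X z ≤ 2) (≡.sym ea) (loop-lowDegree (suc t) (s≤s z≤n) lt)) (subst (λ z → adj X z x ≡ true) (≡.sym ea) (trans (sym X _ _) (cycleEdge-adj e1 ce)))))

  pendant∉cycle : ∀ (e : Cycle Z) i → vert e i ≢ v
  pendant∉cycle e i q = prev≢next e i (trans (onlyNbr _ (subst (λ z → adj Z z _ ≡ true) q (adj-prev e i)))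
                                       (≡.sym (onlyNbr _ (subst (λ z → adj Z z _ ≡ true) q (adj-next e i)))))

  oldCycle-avoids-loop : ∀ (d : Cycle X) (od : InImage ι d) s → 1 ≤ s → s ≤ suc K → OnCycle d (loop s) → ⊥
  oldCycle-avoids-loop d od (suc zero) _ _ (i , ei) = pendant∉cycle (pullCycle ι d od) i (injective ι _ _ (trans (pullCycle-vert ι d od i) ei))
  oldCycle-avoids-loop d od (suc (suc s')) _ ls (i , ei) = old≢new _ _ (trans (pullCycle-vert ι d od i) (trans ei (threadVertex-< s' (index< s' ls))))

  new-old-disjoint : ∀ (c d : Cycle X) → NewCycle c → (od : InImage ι d) → ∀ {x y} → CycleEdge c x y → CycleEdge d x y → ⊥
  new-old-disjoint c d nc od {x} {y} ce de with cycleEdge-ends c ce | cycleEdge-ends d de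
  ... | (ox , oy) | (dx , dy) with NewCycleFacts.subOn c nc x ox | NewCycleFacts.subOn c nc y oy
  ... | (zero , _ , refl) | (zero , _ , refl) = true≢false (trans (≡.sym (cycleEdge-adj c ce)) (irrefl X _))
  ... | (suc s , ls , refl) | _ = oldCycle-avoids-loop d od (suc s) (s≤s z≤n) ls dx
  ... | (zero , _ , refl) | (suc t , lt , refl) = oldCycle-avoids-loop d od (suc t) (s≤s z≤n) lt dy

  thread∈GA : InGA A X
  thread∈GA = cA , cB , cC
    where
    cA : ∀ c → A (cycleLength c)
    cA c with new⊎old-cycle c
    ... | inj₁ nc = subst A (≡.sym (NewCycleFacts.length≡ c nc)) Aℓ
    ... | inj₂ od = lengths∈A (pullCycle ι c od)
    toD : ∀ c → NewCycle c → ∀ x y → CycleEdge c x y → CycleEdge threadCycle x y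
    toD c nc = transferEdge c threadCycle (NewCycleFacts.subOn c nc) (λ s le → OnLoop⇒OnThreadCycle (loop s) (s , le , refl))
    fromD : ∀ c → NewCycle c → ∀ x y → CycleEdge threadCycle x y → CycleEdge c x y
    fromD c nc = transferEdge threadCycle c (λ z o → OnThreadCycle⇒OnLoop z o) (NewCycleFacts.allOn c nc)
    cB : ∀ (c d : Cycle X) x y → CycleEdge c x y → CycleEdge d x y → SameCycle c d
    cB c d x y ce de with new⊎old-cycle c | new⊎old-cycle d
    ... | inj₁ nc | inj₁ nd = λ a b → mk⇔ (λ q → fromD d nd a b (toD c nc a b q)) (λ q → fromD c nc a b (toD d nd a b q))
    ... | inj₁ nc | inj₂ od = ⊥-elim (new-old-disjoint c d nc od ce de)
    ... | inj₂ oc | inj₁ nd = ⊥-elim (new-old-disjoint d c nd oc de ce)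
    ... | inj₂ oc | inj₂ od = pulledCycles-shareNoEdge ι share c d oc od ce de
    cC : ∀ c → highDegreeCount c ≤ 2
    cC c with new⊎old-cycle c
    ... | inj₁ nc = count≤2 _ (vert c) (old u) (old u) (inj c) allIn
      where
      allIn : ∀ i → highᵇ X (vert c i) ≡ true → vert c i ≡ old u ⊎ vert c i ≡ old u
      allIn i hx with NewCycleFacts.sub c nc i
      ... | (zero , _ , e) = inj₁ (≡.sym e)
      ... | (suc s , ls , e) = ⊥-elim (ℕₚ.<⇒≱ (subst (λ z → 3 ≤ degree X z) (≡.sym e) (highᵇ⇒High X _ hx)) (loop-lowDegree (suc s) (s≤s z≤n) ls))
    ... | inj₂ od = subst (_≤ 2) (≡.sym (count-cong eqv)) (≤2high c')
      where
      c' = pullCycle ι c od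
      ve : ∀ i → old (vert c' i) ≡ vert c i
      ve i = pullCycle-vert ι c od i
      eqv : ∀ i → highᵇ X (vert c i) ≡ highᵇ Z (vert c' i)
      eqv i with vert c' i Finₚ.≟ u
      ... | yes eu = trans (High⇒highᵇ X _ (subst (High X) (ve i) (High-mono ι _ hZ))) (≡.sym (High⇒highᵇ Z _ hZ))
        where
        hZ : High Z (vert c' i)
        hZ = subst (High Z) (≡.sym eu) (3≤count (adj Z u) (prev≢next c' i)
               (pendant∉cycle c' (cpred i)) (pendant∉cycle c' (csuc i))
               (subst (λ z → adj Z z (prev c' i) ≡ true) eu (adj-prev c' i)) (subst (λ z → adj Z z (next c' i) ≡ true) eu (adj-next c' i)) u~v)
      ... | no nu = subst (λ z → highᵇ X z ≡ highᵇ Z (vert c' i)) (ve i) (cong (2 <ᵇ_) (degree-reflect ι w nb))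
        where
        w = vert c' i
        nb : ∀ y → adj X (old w) y ≡ true → ∃ λ y' → old y' ≡ y
        nb y a with old⊎new y
        ... | inj₁ r = r
        ... | inj₂ (j , refl) with does⇒ (endEdge? w j) (trans (≡.sym (adj-old-new w j)) a)
        ...   | inj₁ (wv , _) = ⊥-elim (pendant∉cycle c' i wv)
        ...   | inj₂ (wu , _) = ⊥-elim (nu wu)




adjK₂ : Fin 2 → Fin 2 → Bool
adjK₂ x y = not (does (x Finₚ.≟ y))

K₂ : Graph
K₂ = record { size = 2 ; adj = adjK₂ ; sym = adjK₂-sym ; irrefl = λ x → cong not (dec-true (x Finₚ.≟ x) refl) }
  where
  adjK₂-sym : ∀ x y → adjK₂ x y ≡ adjK₂ y x
  adjK₂-sym x y = cong not (does-⇔ (mk⇔ ≡.sym ≡.sym) (x Finₚ.≟ y) (y Finₚ.≟ x))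

K₂-acyclic : ¬ Cycle K₂
K₂-acyclic c = ℕₚ.<⇒≱ (s≤s (s≤s (s≤s z≤n))) (ℕₚ.≤-trans (ℕₚ.m≤m+n 3 (m c)) (Finₚ.injective⇒≤ {f = vert c} λ {i} {j} → inj c i j))

K₂∈GA : ∀ A → InGA A K₂
K₂∈GA A = (λ c → ⊥-elim (K₂-acyclic c)) , (λ c _ _ _ _ _ → ⊥-elim (K₂-acyclic c)) , (λ c → ⊥-elim (K₂-acyclic c))

csuc-zero : ∀ {k} → csuc {suc (suc k)} Fin.zero ≡ Fin.suc Fin.zero
csuc-zero {k} = toℕ-injective (toℕ-csuc-< {suc (suc k)} Fin.zero (s≤s (s≤s z≤n)))

module _ (A : ℕ → Set) where

  Amalgam : ∀ {Z X Y} → Embedding Z X → Embedding Z Y → Set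
  Amalgam {X = X} {Y} f g = Σ Graph λ W → InGA A W × Σ (Embedding X W) λ f′ → Σ (Embedding Y W) λ g′ →
    ∀ z → fun f′ (fun f z) ≡ fun g′ (fun g z)

  Amalgamable : Graph → Set
  Amalgamable Z = ∀ X Y → InGA A X → InGA A Y → (f : Embedding Z X) (g : Embedding Z Y) → Amalgam f g

  module _ {Z : Graph} (Z∈ : InGA A Z) (amalgamable : Amalgamable Z) where

    pendant⇒¬amalgamable : PendantEdge Z → ∀ {k l} → k < l → A (3 + k) → A (3 + l) → ⊥
    pendant⇒¬amalgamable (v , u , v~u , onlyNbr) {k} {l} k<l Aₖ Aₗ =
      noAmalgam (amalgamable _ _ (thread∈GA A Z Z∈ u v u≢v u~v onlyNbr k Aₖ) (thread∈GA A Z Z∈ u v u≢v u~v onlyNbr l Aₗ) TX.ι TY.ι)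
      where
      u≢v : u ≢ v
      u≢v refl = true≢false (trans (≡.sym v~u) (irrefl Z u))
      u~v : adj Z u v ≡ true
      u~v = trans (sym Z u v) v~u
      module TX = Thread Z u v k
      module TY = Thread Z u v l
      noAmalgam : Amalgam TX.ι TY.ι → ⊥
      noAmalgam (W , W∈ , f′ , g′ , commute) =
        ℕₚ.<⇒≱ (s≤s (s≤s (s≤s k<l)))
          (OnCycle⊆⇒length≤ DY DX (λ i → sharedEdge⇒OnCycle⊆ (proj₁ (proj₂ W∈)) DY DX uvY uvX (vert DY i) (i , refl)))
        where
        DX DY : Cycle W
        DX = mapCycle f′ (TX.ThroughPendant.threadCycle u≢v u~v onlyNbr)
        DY = mapCycle g′ (TY.ThroughPendant.threadCycle u≢v u~v onlyNbr)
        uvX : CycleEdge DX (fun f′ (TX.old u)) (fun f′ (TX.old v))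
        uvX = Fin.zero , inj₁ (refl , cong (vert DX) csuc-zero)
        uvY : CycleEdge DY (fun f′ (TX.old u)) (fun f′ (TX.old v))
        uvY = Fin.zero , inj₁ (≡.sym (commute u) , trans (cong (vert DY) csuc-zero) (≡.sym (commute v)))

    leafCycle⇒¬amalgamable : (C : Cycle Z) → highDegreeCount C ≤ 1 → ⊥
    leafCycle⇒¬amalgamable C ≤1 = noAmalgam (amalgamable _ _ X∈ Y∈ LX.ι LY.ι)
      where
      pick : Σ (Fin (3 + m C)) λ t₁ → ∀ i → High Z (vert C i) → i ≡ t₁
      pick with Finₚ.any? (λ i → High? Z (vert C i))
      ... | yes (t , high-t) = t , λ i high-i → unique (i Finₚ.≟ t) high-i
        where
        unique : ∀ {i} → Dec (i ≡ t) → High Z (vert C i) → i ≡ t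
        unique (yes e) _ = e
        unique (no i≢t) high-i = ⊥-elim (ℕₚ.<⇒≱ (s≤s ≤1) (2≤count _ i≢t (High⇒highᵇ Z _ high-i) (High⇒highᵇ Z _ high-t)))
      ... | no none = Fin.zero , λ i high-i → ⊥-elim (none (i , high-i))
      t₁ t₂ t₃ : Fin (3 + m C)
      t₁ = proj₁ pick
      t₂ = csuc t₁
      t₃ = cpred t₁
      module LX = TwoLeaves Z (vert C t₁) (vert C t₂)
      module LY = TwoLeaves Z (vert C t₁) (vert C t₃)
      X∈ : InGA A LX.X
      X∈ = twoLeaves∈GA A Z Z∈ C t₁ t₂ (proj₂ pick)
      Y∈ : InGA A LY.X
      Y∈ = twoLeaves∈GA A Z Z∈ C t₁ t₃ (proj₂ pick)
      noAmalgam : Amalgam LX.ι LY.ι → ⊥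
      noAmalgam (W , W∈ , f′ , g′ , commute) = ℕₚ.<⇒≱ (s≤s (s≤s (s≤s z≤n))) (ℕₚ.≤-trans three-high (proj₂ (proj₂ W∈) CW))
        where
        CW : Cycle W
        CW = mapCycle f′ (mapCycle LX.ι C)
        anchor-high : ∀ {a b} (t : Fin (3 + m C)) (j : Fin 2) → TwoLeaves.anchor Z a b j ≡ vert C t →
          High (TwoLeaves.X Z a b) (TwoLeaves.old Z a b (vert C t))
        anchor-high {a} {b} t j e = subst (High (TwoLeaves.X Z a b) ∘ TwoLeaves.old Z a b) e
          (TwoLeaves.anchor-high Z a b j (prev C t) (next C t) (prev≢next C t)
            (subst (λ z → adj Z z (prev C t) ≡ true) (≡.sym e) (adj-prev C t))
            (subst (λ z → adj Z z (next C t) ≡ true) (≡.sym e) (adj-next C t)))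
        three-high : 3 ≤ highDegreeCount CW
        three-high = 3≤count (λ j → highᵇ W (vert CW j))
          (λ e → csuc≢id t₁ (≡.sym e)) (λ e → cpred≢id t₁ (≡.sym e)) (λ e → cpred≢csuc t₁ (≡.sym e))
          (High⇒highᵇ W _ (High-mono f′ _ (anchor-high t₁ Fin.zero refl)))
          (High⇒highᵇ W _ (High-mono f′ _ (anchor-high t₂ (Fin.suc Fin.zero) refl)))
          (High⇒highᵇ W _ (subst (High W) (≡.sym (commute (vert C t₃))) (High-mono g′ _ (anchor-high t₃ (Fin.suc Fin.zero) refl))))

twoLengths : ∀ {A : ℕ → Set} → (∀ a → A a → 3 ≤ a) → Σ ℕ (λ a → Σ ℕ (λ b → a ≢ b × A a × A b)) →
  Σ ℕ λ k → Σ ℕ λ l → k < l × A (3 + k) × A (3 + l)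
twoLengths {A} A≥3 (a , b , a≢b , Aa , Ab) with ℕₚ.<-cmp a b
... | Tri.tri< a<b _ _ = a ∸ 3 , b ∸ 3 , ℕₚ.∸-monoˡ-< a<b (A≥3 a Aa) , shift Aa , shift Ab
  where
  shift : ∀ {c} → A c → A (3 + (c ∸ 3))
  shift {c} Ac = subst A (≡.sym (ℕₚ.m+[n∸m]≡n (A≥3 c Ac))) Ac
... | Tri.tri≈ _ a≡b _ = ⊥-elim (a≢b a≡b)
... | Tri.tri> _ _ b<a = b ∸ 3 , a ∸ 3 , ℕₚ.∸-monoˡ-< b<a (A≥3 b Ab) , shift Ab , shift Aa
  where
  shift : ∀ {c} → A c → A (3 + (c ∸ 3))
  shift {c} Ac = subst A (≡.sym (ℕₚ.m+[n∸m]≡n (A≥3 c Ac))) Ac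

mainTheorem9 : (A : ℕ → Set) → (∀ a → A a → 3 ≤ a) →
    Σ ℕ (λ a → Σ ℕ (λ b → a ≢ b × A a × A b)) →
    ¬ CAP (InGA A)
mainTheorem9 A A≥3 twoInA cap with cap K₂ (K₂∈GA A)
... | Z , Z∈ , e , amalgamable
    with pendant⊎leafCycle (proj₁ (proj₂ Z∈)) (fun e Fin.zero) (fun e (Fin.suc Fin.zero)) (adj-pres e Fin.zero (Fin.suc Fin.zero))
...   | inj₁ pe = let (k , l , k<l , Aₖ , Aₗ) = twoLengths A≥3 twoInA in
                  pendant⇒¬amalgamable A Z∈ amalgamable pe k<l Aₖ Aₗ
...   | inj₂ (C , ≤1) = leafCycle⇒¬amalgamable A Z∈ amalgamable C ≤1
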